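{- We have \[ \mathbf{G}(x,u,q) = \sum_{k=0}^{\infty} \mathbf{P}_k(x,u,q) \cdot \Big( \mathbf{B}(x,q^k u,q) - \mathbf{N}(x,q^k u,q) \, \mathbf{G}(x,1,q) \Big), \] with \[ \mathbf{P}_k(x,u,q) := \prod_{j=0}^{k-1} \mathbf{M}(x,q^j u,q), \quad \mathbf{P}_{0}(x,u,q)= \mathbf{I}, \] where $\mathbf{I}$ is the $4\times 4$ identity matrix, and \[\mathbf{M}(x,u,q)= \begin{pmatrix} 0& 0 & \frac{xuq}{qu-1} & \frac{xuq}{qu-1} \\ 0& 0 & \frac{xu^2q}{qu-1} & \frac{xu}{qu-1}\\ \frac{xuq}{qu-1} & \frac{xuq}{qu-1} & 0 & 0 \\ \frac{xu^2q^2}{qu-1} & \frac{xuq}{qu-1} & 0 & 0 \end{pmatrix}, \quad \mathbf{N}(x,u,q)= \begin{pmatrix} 0& 0 & \frac{xuq}{qu-1} & \frac{xuq}{qu-1} \\ 0& 0 & \frac{xu}{qu-1} & \frac{xu}{qu-1}\\ \frac{xuq}{qu-1} & \frac{xuq}{qu-1} & 0 & 0 \\ \frac{xuq}{qu-1} & \frac{xuq}{qu-1} & 0 & 0 \end{pmatrix}, \quad \mathbf{B}(x,u,q)= \begin{pmatrix} 0\\ 0\\ 0\\ xuq \end{pmatrix}. \]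
   Context: A Catalan word is a sequence $w_1\cdots w_n$ of nonnegative integers with $w_1=0$ and $w_i\le w_{i-1}+1$. Its Catalan polyomino $P$ has, at position $i$, a column of $w_i+1$ cells, all columns bottom-aligned. Cells are colored in a chessboard pattern with the southwestern cell black; $\mathrm{bck}(P)$ is the number of black cells, $\mathrm{len}(P)$ the number of columns, and $\mathrm{last}(P)$ the number of cells in the last column. For $a,b\in\{0,1\}$, $F_{ab}(x,u,q)=\sum_P x^{\mathrm{len}(P)}u^{\mathrm{last}(P)}q^{\mathrm{bck}(P)}$, summed over Catalan polyominoes with $\mathrm{len}(P)\equiv a$ and $\mathrm{last}(P)\equiv b \pmod 2$. Define $G_{00}(x,u,q)=F_{00}(x,\sqrt{u},q)$, $G_{01}(x,u,q)=\sqrt{u}F_{01}(x,\sqrt{u},q)$, $G_{10}(x,u,q)=F_{10}(x,\sqrt{u},q)$, $G_{11}(x,u,q)=\sqrt{u}F_{11}(x,\sqrt{u},q)$, and $\mathbf{G}(x,u,q)=(G_{00},G_{01},G_{10},G_{11})^T(x,u,q)$. These satisfy the matrix functional equation $\mathbf{G}(x,u,q)=\mathbf{M}(x,u,q)\mathbf{G}(x,qu,q)-\mathbf{N}(x,u,q)\mathbf{G}(x,1,q)+\mathbf{B}(x,u,q)$, and the stated formula is obtained by iterating it. -}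

module Defs where

open import Data.Bool using (Bool; true; false; if_then_else_; _∧_)
open import Data.Nat using (ℕ; zero; suc; _∸_; _≤ᵇ_; _≡ᵇ_; ⌊_/2⌋; ⌈_/2⌉)
import Data.Nat as ℕ
open import Data.Integer using (ℤ; +_; 0ℤ; 1ℤ; -_; _+_; _*_; _-_)
open import Data.List using (List; []; _∷_; map; concatMap; upTo)
open import Data.Fin using (Fin; zero; suc)

catTail : ℕ → List ℕ → Bool
catTail prev []       = true
catTail prev (w ∷ ws) = (w ≤ᵇ suc prev) ∧ catTail w ws

isCatalan : List ℕ → Bool
isCatalan []       = false
isCatalan (w ∷ ws) = (w ≡ᵇ 0) ∧ catTail w ws

listsOf : ℕ → ℕ → List (List ℕ)
listsOf zero    b = [] ∷ []
listsOf (suc n) b = concatMap (λ v → map (v ∷_) (listsOf n b)) (upTo b)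
-- Every Catalan word of length n has all entries < n (since w_i ≤ i-1),
-- so the Catalan words of length n are exactly the Catalan members of listsOf n n.

-- Black cells in a column with w+1 cells (heights 0..w); the column is at
-- a (0-based) even position iff the flag is true.  The southwestern cell
-- (column 0, height 0) is black; cell (c, j) is black iff c + j is even.
blackInCol : Bool → ℕ → ℕ
blackInCol true  w = suc ⌊ w /2⌋      -- heights j even in 0..w
blackInCol false w = ⌈ w /2⌉          -- heights j odd in 0..w

bckFrom : Bool → List ℕ → ℕ
bckFrom e []       = 0
bckFrom e (w ∷ ws) = blackInCol e w ℕ.+ bckFrom (not e) ws
  where
  not : Bool → Bool
  not true = false
  not false = true

bck : List ℕ → ℕ
bck = bckFrom true

lastCells : List ℕ → ℕ
lastCells []           = 0
lastCells (w ∷ [])     = suc w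
lastCells (w ∷ v ∷ ws) = lastCells (v ∷ ws)

parity : ℕ → ℕ
parity zero          = 0
parity (suc zero)    = 1
parity (suc (suc n)) = parity n

countB : {A : Set} → (A → Bool) → List A → ℕ
countB p []       = 0
countB p (a ∷ as) = if p a then suc (countB p as) else countB p as

-- Formal power series in x, u, q with integer coefficients:
-- s n a c = coefficient of x^n u^a q^c.

Ser : Set
Ser = ℕ → ℕ → ℕ → ℤ

-- index i of the vector G = (G00, G01, G10, G11): parity of len and of last
lenPar lastPar : Fin 4 → ℕ
lenPar zero                   = 0
lenPar (suc zero)             = 0
lenPar (suc (suc zero))       = 1
lenPar (suc (suc (suc zero))) = 1
lastPar zero                   = 0
lastPar (suc zero)             = 1
lastPar (suc (suc zero))       = 0
lastPar (suc (suc (suc zero))) = 1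

-- G_ab(x,u,q): the sqrt u substitution (with the extra sqrt u factor when
-- last is odd) turns u^last into u^⌈last/2⌉ in every case.
G : Fin 4 → Ser
G i n e c = + countB (λ w → isCatalan w ∧ (parity n ≡ᵇ lenPar i)
                        ∧ (parity (lastCells w) ≡ᵇ lastPar i)
                        ∧ (⌈ lastCells w /2⌉ ≡ᵇ e) ∧ (bck w ≡ᵇ c))
                      (listsOf n n)

G1 : Fin 4 → Ser
G1 i n zero    c = + countB (λ w → isCatalan w ∧ (parity n ≡ᵇ lenPar i)
                        ∧ (parity (lastCells w) ≡ᵇ lastPar i)
                        ∧ (bck w ≡ᵇ c))
                      (listsOf n n)
G1 i n (suc e) c = 0ℤ

sumTo : ℕ → (ℕ → ℤ) → ℤ
sumTo zero    f = f 0
sumTo (suc n) f = sumTo n f + f (suc n)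

zeroS : Ser
zeroS _ _ _ = 0ℤ

_⊕_ : Ser → Ser → Ser
(f ⊕ g) n a c = f n a c + g n a c

_⊖_ : Ser → Ser → Ser
(f ⊖ g) n a c = f n a c - g n a c

_⊛_ : Ser → Ser → Ser
(f ⊛ g) n a c = sumTo n λ i → sumTo a λ j → sumTo c λ l →
                  f i j l * g (n ∸ i) (a ∸ j) (c ∸ l)

mono : ℕ → ℕ → ℕ → Ser
mono n a c n' a' c' = if (n ≡ᵇ n') ∧ (a ≡ᵇ a') ∧ (c ≡ᵇ c') then 1ℤ else 0ℤ

oneS : Ser
oneS = mono 0 0 0

-- 1/(qu - 1) = - Σ_m (qu)^m  in Z[[x,u,q]]
invQU : Ser
invQU zero a c = if a ≡ᵇ c then - 1ℤ else 0ℤ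
invQU (suc n) a c = 0ℤ

-- x u^a q^c / (qu - 1)
frac : ℕ → ℕ → Ser
frac a c = mono 1 a c ⊛ invQU

-- substitution u ↦ q^k u
substU : ℕ → Ser → Ser
substU k f n a c = if k ℕ.* a ≤ᵇ c then f n a (c ∸ k ℕ.* a) else 0ℤ

Mat : Set
Mat = Fin 4 → Fin 4 → Ser

Vec4 : Set
Vec4 = Fin 4 → Ser

sum4 : (Fin 4 → Ser) → Ser
sum4 f = f zero ⊕ (f (suc zero) ⊕ (f (suc (suc zero)) ⊕ f (suc (suc (suc zero)))))

_·_ : Mat → Mat → Mat
(A · B) i j = sum4 λ k → A i k ⊛ B k j

_▸_ : Mat → Vec4 → Vec4
(A ▸ v) i = sum4 λ k → A i k ⊛ v k

I : Mat
I zero zero = oneS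
I (suc zero) (suc zero) = oneS
I (suc (suc zero)) (suc (suc zero)) = oneS
I (suc (suc (suc zero))) (suc (suc (suc zero))) = oneS
I _ _ = zeroS

i0 i1 i2 i3 : Fin 4
i0 = zero
i1 = suc zero
i2 = suc (suc zero)
i3 = suc (suc (suc zero))

M : Mat
M zero (suc (suc zero))                         = frac 1 1
M zero (suc (suc (suc zero)))                   = frac 1 1
M (suc zero) (suc (suc zero))                   = frac 2 1
M (suc zero) (suc (suc (suc zero)))             = frac 1 0
M (suc (suc zero)) zero                         = frac 1 1
M (suc (suc zero)) (suc zero)                   = frac 1 1
M (suc (suc (suc zero))) zero                   = frac 2 2
M (suc (suc (suc zero))) (suc zero)             = frac 1 1
M _ _ = zeroS

N : Mat
N zero (suc (suc zero))                         = frac 1 1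
N zero (suc (suc (suc zero)))                   = frac 1 1
N (suc zero) (suc (suc zero))                   = frac 1 0
N (suc zero) (suc (suc (suc zero)))             = frac 1 0
N (suc (suc zero)) zero                         = frac 1 1
N (suc (suc zero)) (suc zero)                   = frac 1 1
N (suc (suc (suc zero))) zero                   = frac 1 1
N (suc (suc (suc zero))) (suc zero)             = frac 1 1
N _ _ = zeroS

B : Vec4
B (suc (suc (suc zero))) = mono 1 1 1
B _ = zeroS

Mq Nq : ℕ → Mat
Mq j r s = substU j (M r s)
Nq k r s = substU k (N r s)

Bq : ℕ → Vec4
Bq k r = substU k (B r)

P : ℕ → Mat
P zero    = I
P (suc k) = P k · Mq k

term : ℕ → Vec4
term k = P k ▸ (λ r → Bq k r ⊖ (Nq k ▸ G1) r)

-- Write G_k, M_k, N_k, B_k for G, M, N, B with u replaced by q^k u. The functional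
-- equation G_k = M_k G_(k+1) + B_k − N_k G(x,1,q) telescopes to
--   G = Σ_(k<K) P_k (B_k − N_k G(x,1,q)) + P_K G_K.
-- Every entry of M, N and B is divisible by x, so P_K is divisible by x^K and the k-th
-- summand by x^(k+1); comparing coefficients of x^n with K = n + 1 gives the formula.
--
-- Removing the last column of a
-- Catalan polyomino of length n + 2 leaves one of length n + 1, and the removed column
-- was allowed iff it is at most one cell higher than the new last column. Since
-- 1/(qu − 1) = −Σ_m (qu)^m, an M-entry sums the shorter polyominoes whose last column
-- lies below that threshold while the matching N-entry counts all of them, so
-- M_k G_(k+1) − N_k G(x,1,q) counts exactly those that can be extended.

module Submission where

open import Level using (0ℓ)
open import Algebra.Bundles using (Semiring; SemiringWithoutOne)
open import Function using (_$_)
open import Relation.Binary.Bundles using (Setoid)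
import Relation.Binary.Reasoning.Setoid
open import Data.Nat using (ℕ; zero; suc; _∸_; _≤_; _<_; z≤n; s≤s; ⌈_/2⌉; ⌊_/2⌋)
import Data.Nat as ℕ
import Data.Nat.Properties as ℕₚ
open import Algebra.Properties.CommutativeSemigroup ℕₚ.+-commutativeSemigroup using ()
  renaming (interchange to +-interchange)
open import Data.Integer using (ℤ; 0ℤ; -1ℤ; +_)
import Data.Integer as ℤ
import Data.Integer.Properties as ℤₚ
open import Data.Integer.Solver using () renaming (module +-*-Solver to ℤ-Solver)
open import Data.Nat.Solver using () renaming (module +-*-Solver to ℕ-Solver)
open import Data.Fin using (Fin; zero; suc)
open import Data.List using (List; []; _∷_; _∷ʳ_; _++_; length; map; concat; concatMap; upTo; applyUpTo)
open import Data.Nat.ListAction using (sum)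
open import Data.Product using (_×_; _,_)
open import Data.Empty using (⊥-elim)
open import Data.Bool using (Bool; true; false; if_then_else_; _∧_; not; T)
open import Data.Bool.Properties using (∧-zeroʳ; ∧-identityʳ; ∧-assoc; not-involutive)
open import Relation.Nullary.Decidable using (dec-true; dec-false)
open import Relation.Binary.Definitions using (tri<; tri≈; tri>)
open import Relation.Nullary using (yes; no)
open import Relation.Binary.PropositionalEquality as ≡ using (_≡_; _≢_; refl)

open import Defs

-- Convolution of power series

module Convolution {c ℓ} (R : SemiringWithoutOne c ℓ) where

  open SemiringWithoutOne R renaming (refl to ≈-refl)
  open import Relation.Binary.Reasoning.Setoid setoid
  open import Algebra.Properties.CommutativeSemigroup +-commutativeSemigroup using (interchange)

  ∑ : ℕ → (ℕ → Carrier) → Carrier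
  ∑ zero    f = f 0
  ∑ (suc n) f = ∑ n f + f (suc n)

  ∑-cong≤ : ∀ n {f g} → (∀ i → i ≤ n → f i ≈ g i) → ∑ n f ≈ ∑ n g
  ∑-cong≤ zero    f≈g = f≈g 0 z≤n
  ∑-cong≤ (suc n) f≈g = +-cong (∑-cong≤ n (λ i i≤n → f≈g i (ℕₚ.m≤n⇒m≤1+n i≤n))) (f≈g (suc n) ℕₚ.≤-refl)

  ∑-cong : ∀ n {f g} → (∀ i → f i ≈ g i) → ∑ n f ≈ ∑ n g
  ∑-cong n f≈g = ∑-cong≤ n (λ i _ → f≈g i)

  ∑-zero : ∀ n {f} → (∀ i → f i ≈ 0#) → ∑ n f ≈ 0#
  ∑-zero zero    f≈0 = f≈0 0
  ∑-zero (suc n) f≈0 = trans (+-cong (∑-zero n f≈0) (f≈0 (suc n))) (+-identityʳ 0#)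

  ∑-distrib-+ : ∀ n f g → ∑ n (λ i → f i + g i) ≈ ∑ n f + ∑ n g
  ∑-distrib-+ zero    f g = ≈-refl
  ∑-distrib-+ (suc n) f g = trans (+-congʳ (∑-distrib-+ n f g)) (interchange _ _ _ _)

  ∑-distribʳ-* : ∀ n f y → ∑ n f * y ≈ ∑ n (λ i → f i * y)
  ∑-distribʳ-* zero    f y = ≈-refl
  ∑-distribʳ-* (suc n) f y = trans (distribʳ y (∑ n f) (f (suc n))) (+-congʳ (∑-distribʳ-* n f y))

  ∑-distribˡ-* : ∀ n f y → y * ∑ n f ≈ ∑ n (λ i → y * f i)
  ∑-distribˡ-* zero    f y = ≈-refl
  ∑-distribˡ-* (suc n) f y = trans (distribˡ y (∑ n f) (f (suc n))) (+-congʳ (∑-distribˡ-* n f y))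

  ∑-triangle : ∀ n (F : ℕ → ℕ → Carrier) →
               ∑ n (λ i → ∑ i (F i)) ≈ ∑ n (λ j → ∑ (n ∸ j) (λ k → F (j ℕ.+ k) j))
  ∑-triangle zero    F = ≈-refl
  ∑-triangle (suc n) F = begin
    ∑ n (λ i → ∑ i (F i)) + ∑ (suc n) (F (suc n))
      ≈⟨ +-congʳ (∑-triangle n F) ⟩
    ∑ n (λ j → ∑ (n ∸ j) (H j)) + (∑ n (F (suc n)) + F (suc n) (suc n))
      ≈⟨ +-assoc _ _ _ ⟨
    (∑ n (λ j → ∑ (n ∸ j) (H j)) + ∑ n (F (suc n))) + F (suc n) (suc n)
      ≈⟨ +-cong (∑-distrib-+ n _ _) (reflexive (≡.cong (λ m → F m (suc n)) (ℕₚ.+-identityʳ (suc n)))) ⟨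
    ∑ n (λ j → ∑ (n ∸ j) (H j) + F (suc n) j) + H (suc n) 0
      ≈⟨ +-congʳ (∑-cong≤ n (λ j j≤n → sym (row j j≤n))) ⟩
    ∑ n (λ j → ∑ (suc n ∸ j) (H j)) + ∑ 0 (H (suc n))
      ≡⟨ ≡.cong (λ m → ∑ n (λ j → ∑ (suc n ∸ j) (H j)) + ∑ m (H (suc n))) (ℕₚ.n∸n≡0 n) ⟨
    ∑ (suc n) (λ j → ∑ (suc n ∸ j) (H j)) ∎
    where
    H : ℕ → ℕ → Carrier
    H j k = F (j ℕ.+ k) j
    row : ∀ j → j ≤ n → ∑ (suc n ∸ j) (H j) ≈ ∑ (n ∸ j) (H j) + F (suc n) j
    row j j≤n rewrite ℕₚ.+-∸-assoc 1 j≤n =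
      +-congˡ (reflexive (≡.cong (λ m → F m j) (≡.trans (ℕₚ.+-suc j (n ∸ j)) (≡.cong suc (ℕₚ.m+[n∸m]≡n j≤n)))))

  Series : Set c
  Series = ℕ → Carrier

  _⋆_ : Series → Series → Series
  (x ⋆ y) n = ∑ n (λ i → x i * y (n ∸ i))

  ⋆-assoc : ∀ x y z n → ((x ⋆ y) ⋆ z) n ≈ (x ⋆ (y ⋆ z)) n
  ⋆-assoc x y z n = begin
    ∑ n (λ i → ∑ i (λ j → x j * y (i ∸ j)) * z (n ∸ i))
      ≈⟨ ∑-cong n (λ i → ∑-distribʳ-* i _ (z (n ∸ i))) ⟩
    ∑ n (λ i → ∑ i (λ j → (x j * y (i ∸ j)) * z (n ∸ i)))
      ≈⟨ ∑-triangle n (λ i j → (x j * y (i ∸ j)) * z (n ∸ i)) ⟩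
    ∑ n (λ j → ∑ (n ∸ j) (λ k → (x j * y (j ℕ.+ k ∸ j)) * z (n ∸ (j ℕ.+ k))))
      ≈⟨ ∑-cong n (λ j → ∑-cong (n ∸ j) (λ k → trans (reindex j k) (*-assoc (x j) (y k) _))) ⟩
    ∑ n (λ j → ∑ (n ∸ j) (λ k → x j * (y k * z (n ∸ j ∸ k))))
      ≈⟨ ∑-cong n (λ j → ∑-distribˡ-* (n ∸ j) _ (x j)) ⟨
    ∑ n (λ j → x j * ∑ (n ∸ j) (λ k → y k * z (n ∸ j ∸ k))) ∎
    where
    reindex : ∀ j k → (x j * y (j ℕ.+ k ∸ j)) * z (n ∸ (j ℕ.+ k)) ≈ (x j * y k) * z (n ∸ j ∸ k)
    reindex j k = reflexive (≡.cong₂ (λ p r → (x j * y p) * z r) (ℕₚ.m+n∸m≡n j k) (≡.sym (ℕₚ.∸-+-assoc n j k)))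

  seriesSemiringWithoutOne : SemiringWithoutOne c ℓ
  seriesSemiringWithoutOne = record
    { Carrier = Series
    ; _≈_ = λ x y → ∀ n → x n ≈ y n
    ; _+_ = λ x y n → x n + y n
    ; _*_ = _⋆_
    ; 0# = λ _ → 0#
    ; isSemiringWithoutOne = record
      { +-isCommutativeMonoid = record
        { isMonoid = record
          { isSemigroup = record
            { isMagma = record
              { isEquivalence = record
                { refl = λ n → ≈-refl ; sym = λ p n → sym (p n) ; trans = λ p q n → trans (p n) (q n) }
              ; ∙-cong = λ p q n → +-cong (p n) (q n) }
            ; assoc = λ x y z n → +-assoc (x n) (y n) (z n) }
          ; identity = (λ x n → +-identityˡ (x n)) , (λ x n → +-identityʳ (x n)) }
        ; comm = λ x y n → +-comm (x n) (y n) }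
      ; *-cong = λ p q n → ∑-cong n (λ i → *-cong (p i) (q (n ∸ i)))
      ; *-assoc = ⋆-assoc
      ; distrib = (λ x y z n → trans (∑-cong n (λ i → distribˡ (x i) _ _)) (∑-distrib-+ n _ _))
                , (λ x y z n → trans (∑-cong n (λ i → distribʳ (x (n ∸ i)) _ _)) (∑-distrib-+ n _ _))
      ; zero = (λ x n → ∑-zero n (λ i → zeroˡ _)) , (λ x n → ∑-zero n (λ i → zeroʳ _))
      }
    }

sumTo-cong : ∀ n {f g : ℕ → ℤ} → (∀ i → f i ≡ g i) → sumTo n f ≡ sumTo n g
sumTo-cong zero    f≡g = f≡g 0
sumTo-cong (suc n) f≡g = ≡.cong₂ ℤ._+_ (sumTo-cong n f≡g) (f≡g (suc n))

sumTo-cong≤ : ∀ n {f g : ℕ → ℤ} → (∀ i → i ≤ n → f i ≡ g i) → sumTo n f ≡ sumTo n g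
sumTo-cong≤ zero    f≡g = f≡g 0 z≤n
sumTo-cong≤ (suc n) f≡g = ≡.cong₂ ℤ._+_ (sumTo-cong≤ n (λ i i≤n → f≡g i (ℕₚ.m≤n⇒m≤1+n i≤n))) (f≡g (suc n) ℕₚ.≤-refl)

sumTo-zero : ∀ n (g : ℕ → ℤ) → (∀ i → g i ≡ 0ℤ) → sumTo n g ≡ 0ℤ
sumTo-zero zero    g g≡0 = g≡0 0
sumTo-zero (suc n) g g≡0 = ≡.cong₂ ℤ._+_ (sumTo-zero n g g≡0) (g≡0 (suc n))

sumTo-zero≤ : ∀ n (g : ℕ → ℤ) → (∀ i → i ≤ n → g i ≡ 0ℤ) → sumTo n g ≡ 0ℤ
sumTo-zero≤ n g g≡0 = ≡.trans (sumTo-cong≤ n g≡0) (sumTo-zero n _ (λ _ → refl))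

sumTo-head : ∀ n (g : ℕ → ℤ) → (∀ i → g (suc i) ≡ 0ℤ) → sumTo n g ≡ g 0
sumTo-head zero    g g≡0 = refl
sumTo-head (suc n) g g≡0 = ≡.trans (≡.cong₂ ℤ._+_ (sumTo-head n g g≡0) (g≡0 n)) (ℤₚ.+-identityʳ (g 0))

sumTo-last : ∀ n (g : ℕ → ℤ) → (∀ j → j < n → g j ≡ 0ℤ) → sumTo n g ≡ g n
sumTo-last zero    g g≡0 = refl
sumTo-last (suc n) g g≡0 =
  ≡.trans (≡.cong (ℤ._+ g (suc n)) (sumTo-zero≤ n g (λ j j≤n → g≡0 j (s≤s j≤n)))) (ℤₚ.+-identityˡ _)

sumTo-suc-head : ∀ n (g : ℕ → ℤ) → sumTo (suc n) g ≡ g 0 ℤ.+ sumTo n (λ i → g (suc i))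
sumTo-suc-head zero    g = refl
sumTo-suc-head (suc n) g = ≡.trans (≡.cong (ℤ._+ g (suc (suc n))) (sumTo-suc-head n g)) (ℤₚ.+-assoc (g 0) _ _)

sumTo-neg : ∀ n (g : ℕ → ℤ) → sumTo n (λ i → ℤ.- g i) ≡ ℤ.- sumTo n g
sumTo-neg zero    g = refl
sumTo-neg (suc n) g =
  ≡.trans (≡.cong (ℤ._+ ℤ.- g (suc n)) (sumTo-neg n g)) (≡.sym (ℤₚ.neg-distrib-+ (sumTo n g) (g (suc n))))

sumTo-if : ∀ b n (f : ℕ → ℤ) → sumTo n (λ j → if b then f j else 0ℤ) ≡ (if b then sumTo n f else 0ℤ)
sumTo-if true  n f = refl
sumTo-if false n f = sumTo-zero n _ (λ _ → refl)

𝟙 : Bool → ℕ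
𝟙 b = if b then 1 else 0

-- Unlike sumTo t, which ends at f t, these stop at f (t − 1).
sum< : ℕ → (ℕ → ℕ) → ℕ
sum< zero    f = 0
sum< (suc t) f = sum< t f ℕ.+ f t

sum<ℤ : ℕ → (ℕ → ℤ) → ℤ
sum<ℤ zero    f = 0ℤ
sum<ℤ (suc t) f = sum<ℤ t f ℤ.+ f t

sum<ℤ-+ : ∀ t f → sum<ℤ t (λ e → + f e) ≡ + sum< t f
sum<ℤ-+ zero    f = refl
sum<ℤ-+ (suc t) f = ≡.cong (ℤ._+ + f t) (sum<ℤ-+ t f)

sum<-cong : ∀ t {f g} → (∀ e → f e ≡ g e) → sum< t f ≡ sum< t g
sum<-cong zero    f≡g = refl
sum<-cong (suc t) f≡g = ≡.cong₂ ℕ._+_ (sum<-cong t f≡g) (f≡g t)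

sum<-distrib-+ : ∀ t f g → sum< t (λ e → f e ℕ.+ g e) ≡ sum< t f ℕ.+ sum< t g
sum<-distrib-+ zero    f g = refl
sum<-distrib-+ (suc t) f g rewrite sum<-distrib-+ t f g = +-interchange (sum< t f) (sum< t g) (f t) (g t)

sum<-zero : ∀ t f → (∀ e → f e ≡ 0) → sum< t f ≡ 0
sum<-zero zero    f f≡0 = refl
sum<-zero (suc t) f f≡0 rewrite sum<-zero t f f≡0 | f≡0 t = refl

sumTo-reverse : ∀ a F → sumTo a (λ j → F (a ∸ j)) ≡ sum<ℤ (suc a) F
sumTo-reverse zero    F = ≡.sym (ℤₚ.+-identityˡ (F 0))
sumTo-reverse (suc a) F = begin
  sumTo (suc a) (λ j → F (suc a ∸ j))          ≡⟨ sumTo-suc-head a (λ j → F (suc a ∸ j)) ⟩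
  F (suc a) ℤ.+ sumTo a (λ j → F (a ∸ j))      ≡⟨ ≡.cong (ℤ._+_ (F (suc a))) (sumTo-reverse a F) ⟩
  F (suc a) ℤ.+ sum<ℤ (suc a) F                ≡⟨ ℤₚ.+-comm (F (suc a)) _ ⟩
  sum<ℤ (suc (suc a)) F                         ∎
  where open ≡.≡-Reasoning

sum<-suc-head : ∀ b f → sum< (suc b) f ≡ f 0 ℕ.+ sum< b (λ v → f (suc v))
sum<-suc-head zero    f = ℕₚ.+-comm 0 (f 0)
sum<-suc-head (suc b) f rewrite sum<-suc-head b f = ℕₚ.+-assoc (f 0) _ _

sum<-zero< : ∀ N f → (∀ v → v < N → f v ≡ 0) → sum< N f ≡ 0
sum<-zero< zero    f f≡0 = refl
sum<-zero< (suc N) f f≡0 rewrite sum<-zero< N f (λ v v<N → f≡0 v (ℕₚ.m<n⇒m<1+n v<N)) | f≡0 N (ℕₚ.n<1+n N) = refl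

module _ {m n : ℕ} where

  ≤ᵇ≡true⇒≤ : (m ℕ.≤ᵇ n) ≡ true → m ≤ n
  ≤ᵇ≡true⇒≤ e = ℕₚ.≤ᵇ⇒≤ m n (≡.subst T (≡.sym e) _)

  ≤⇒≤ᵇ≡true : m ≤ n → (m ℕ.≤ᵇ n) ≡ true
  ≤⇒≤ᵇ≡true = dec-true (m ℕₚ.≤? n)

  >⇒≤ᵇ≡false : n < m → (m ℕ.≤ᵇ n) ≡ false
  >⇒≤ᵇ≡false n<m = dec-false (m ℕₚ.≤? n) (ℕₚ.<⇒≱ n<m)

  ≤ᵇ≡false⇒> : (m ℕ.≤ᵇ n) ≡ false → n < m
  ≤ᵇ≡false⇒> e = ℕₚ.≰⇒> (λ m≤n → ≡.subst T e (ℕₚ.≤⇒≤ᵇ m≤n))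

  ≡ᵇ≡true⇒≡ : (m ℕ.≡ᵇ n) ≡ true → m ≡ n
  ≡ᵇ≡true⇒≡ e = ℕₚ.≡ᵇ⇒≡ m n (≡.subst T (≡.sym e) _)

  ≡⇒≡ᵇ≡true : m ≡ n → (m ℕ.≡ᵇ n) ≡ true
  ≡⇒≡ᵇ≡true = dec-true (m ℕₚ.≟ n)

  ≢⇒≡ᵇ≡false : m ≢ n → (m ℕ.≡ᵇ n) ≡ false
  ≢⇒≡ᵇ≡false = dec-false (m ℕₚ.≟ n)

  ≡ᵇ≡false⇒≢ : (m ℕ.≡ᵇ n) ≡ false → m ≢ n
  ≡ᵇ≡false⇒≢ e m≡n = ≡.subst T e (ℕₚ.≡⇒≡ᵇ m n m≡n)

≡ᵇ-refl : ∀ n → (n ℕ.≡ᵇ n) ≡ true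
≡ᵇ-refl n = ≡⇒≡ᵇ≡true {n} {n} refl

≡ᵇ-cong-⇔ : ∀ {x y x′ y′} → (x ≡ y → x′ ≡ y′) → (x′ ≡ y′ → x ≡ y) → (x ℕ.≡ᵇ y) ≡ (x′ ℕ.≡ᵇ y′)
≡ᵇ-cong-⇔ {x} {y} to from with x ℕ.≡ᵇ y in e
... | true  = ≡.sym (≡⇒≡ᵇ≡true (to (≡ᵇ≡true⇒≡ e)))
... | false = ≡.sym (≢⇒≡ᵇ≡false (λ x′≡y′ → ≡ᵇ≡false⇒≢ e (from x′≡y′)))

≤ᵇ-cong-⇔ : ∀ {x y x′ y′} → (x ≤ y → x′ ≤ y′) → (x′ ≤ y′ → x ≤ y) → (x ℕ.≤ᵇ y) ≡ (x′ ℕ.≤ᵇ y′)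
≤ᵇ-cong-⇔ {x} {y} to from with x ℕ.≤ᵇ y in e
... | true  = ≡.sym (≤⇒≤ᵇ≡true (to (≤ᵇ≡true⇒≤ e)))
... | false = ≡.sym (>⇒≤ᵇ≡false (ℕₚ.≰⇒> (λ x′≤y′ → ℕₚ.<⇒≱ (≤ᵇ≡false⇒> e) (from x′≤y′))))

+-≡ᵇ : ∀ b d c → (b ℕ.+ d ℕ.≡ᵇ c) ≡ (d ℕ.≤ᵇ c) ∧ (b ℕ.≡ᵇ c ∸ d)
+-≡ᵇ b d c with d ℕ.≤ᵇ c in e
... | true  = ≡ᵇ-cong-⇔ (λ b+d≡c → ≡.trans (≡.sym (ℕₚ.m+n∸n≡m b d)) (≡.cong (_∸ d) b+d≡c))
                        (λ b≡c∸d → ≡.trans (≡.cong (ℕ._+ d) b≡c∸d) (ℕₚ.m∸n+n≡m (≤ᵇ≡true⇒≤ {d} {c} e)))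
... | false = ≢⇒≡ᵇ≡false (λ b+d≡c → ℕₚ.<⇒≱ (≤ᵇ≡false⇒> e) (≡.subst (d ≤_) b+d≡c (ℕₚ.m≤n+m d b)))

+-≡ᵇ′ : ∀ d b c → (d ℕ.+ b ℕ.≡ᵇ c) ≡ (d ℕ.≤ᵇ c) ∧ (b ℕ.≡ᵇ c ∸ d)
+-≡ᵇ′ d b c = ≡.trans (≡.cong (ℕ._≡ᵇ c) (ℕₚ.+-comm d b)) (+-≡ᵇ b d c)

suc-≤ᵇ-suc : ∀ m n → (suc m ℕ.≤ᵇ suc n) ≡ (m ℕ.≤ᵇ n)
suc-≤ᵇ-suc zero    n = refl
suc-≤ᵇ-suc (suc m) n = refl

≤ᵇ-∸ : ∀ x y c → x ≤ c → (y ℕ.≤ᵇ c ∸ x) ≡ (x ℕ.+ y ℕ.≤ᵇ c)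
≤ᵇ-∸ x y c x≤c = ≤ᵇ-cong-⇔
  (λ y≤c∸x → ≡.subst (_≤ c) (ℕₚ.+-comm y x) (ℕₚ.m≤o∸n⇒m+n≤o y x≤c y≤c∸x))
  (λ x+y≤c → ℕₚ.m+n≤o⇒m≤o∸n y (≡.subst (_≤ c) (ℕₚ.+-comm x y) x+y≤c))

if-const : ∀ b {x : ℤ} → (if b then x else x) ≡ x
if-const true  = refl
if-const false = refl

if-≤ᵇ-∸ : ∀ x y c (F : ℕ → ℤ) →
  (if x ℕ.≤ᵇ c then (if y ℕ.≤ᵇ c ∸ x then F (c ∸ x ∸ y) else 0ℤ) else 0ℤ)
    ≡ (if x ℕ.+ y ℕ.≤ᵇ c then F (c ∸ (x ℕ.+ y)) else 0ℤ)
if-≤ᵇ-∸ x y c F with x ℕ.≤ᵇ c in x≤ᵇc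
... | false rewrite >⇒≤ᵇ≡false {x ℕ.+ y} {c} (ℕₚ.<-≤-trans (≤ᵇ≡false⇒> x≤ᵇc) (ℕₚ.m≤m+n x y)) = refl
... | true  rewrite ≤ᵇ-∸ x y c (≤ᵇ≡true⇒≤ x≤ᵇc) | ℕₚ.∸-+-assoc c x y = refl

sumTo-single : ∀ n p (g : ℕ → ℤ) → (∀ i → (p ℕ.≡ᵇ i) ≡ false → g i ≡ 0ℤ) →
               sumTo n g ≡ (if p ℕ.≤ᵇ n then g p else 0ℤ)
sumTo-single zero    zero    g g≡0 = refl
sumTo-single zero    (suc p) g g≡0 = g≡0 0 refl
sumTo-single (suc n) p       g g≡0 with ℕₚ.<-cmp p (suc n)
... | tri< p<1+n p≢1+n _
  rewrite sumTo-single n p g g≡0 | ≤⇒≤ᵇ≡true (ℕₚ.≤-pred p<1+n) | ≤⇒≤ᵇ≡true (ℕₚ.<⇒≤ p<1+n)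
        | g≡0 (suc n) (≢⇒≡ᵇ≡false p≢1+n) = ℤₚ.+-identityʳ (g p)
... | tri≈ _ refl _
  rewrite sumTo-single n p g g≡0 | >⇒≤ᵇ≡false (ℕₚ.n<1+n n) | ≤⇒≤ᵇ≡true (ℕₚ.≤-refl {suc n}) = ℤₚ.+-identityˡ _
... | tri> _ _ 1+n<p
  rewrite sumTo-single n p g g≡0 | >⇒≤ᵇ≡false (ℕₚ.<-trans (ℕₚ.n<1+n n) 1+n<p) | >⇒≤ᵇ≡false 1+n<p
        | g≡0 (suc n) (≢⇒≡ᵇ≡false (ℕₚ.>⇒≢ 1+n<p)) = refl

sumTo-from-reverse : ∀ α a F → sumTo a (λ j → if α ℕ.≤ᵇ j then F (a ∸ j) else 0ℤ) ≡ sum<ℤ (suc a ∸ α) F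
sumTo-from-reverse zero    a       F = sumTo-reverse a F
sumTo-from-reverse (suc α) zero    F rewrite ℕₚ.0∸n≡0 α = refl
sumTo-from-reverse (suc α) (suc a) F =
  ≡.trans (sumTo-suc-head a _) (≡.trans (ℤₚ.+-identityˡ _)
    (≡.trans (sumTo-cong a (λ j → ≡.cong (λ b → if b then F (a ∸ j) else 0ℤ) (suc-≤ᵇ-suc α j))) (sumTo-from-reverse α a F)))

𝟙-≤ᵇ-suc : ∀ t g → 𝟙 (t ℕ.≤ᵇ g) ≡ 𝟙 (suc t ℕ.≤ᵇ g) ℕ.+ 𝟙 (g ℕ.≡ᵇ t)
𝟙-≤ᵇ-suc t g with ℕₚ.<-cmp g t
... | tri< g<t g≢t _
  rewrite >⇒≤ᵇ≡false g<t | >⇒≤ᵇ≡false (ℕₚ.m<n⇒m<1+n g<t) | ≢⇒≡ᵇ≡false g≢t = refl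
... | tri≈ _ refl _
  rewrite ≤⇒≤ᵇ≡true (ℕₚ.≤-refl {g}) | >⇒≤ᵇ≡false (ℕₚ.n<1+n g) | ≡ᵇ-refl g = refl
... | tri> _ g≢t t<g
  rewrite ≤⇒≤ᵇ≡true (ℕₚ.<⇒≤ t<g) | ≤⇒≤ᵇ≡true t<g | ≢⇒≡ᵇ≡false g≢t = refl

𝟙-partition : ∀ t g → 1 ≡ 𝟙 (t ℕ.≤ᵇ g) ℕ.+ sum< t (λ e → 𝟙 (g ℕ.≡ᵇ e))
𝟙-partition zero    g = refl
𝟙-partition (suc t) g = begin
  1                                                                       ≡⟨ 𝟙-partition t g ⟩
  𝟙 (t ℕ.≤ᵇ g) ℕ.+ S                                                     ≡⟨ ≡.cong (ℕ._+ S) (𝟙-≤ᵇ-suc t g) ⟩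
  𝟙 (suc t ℕ.≤ᵇ g) ℕ.+ 𝟙 (g ℕ.≡ᵇ t) ℕ.+ S                                ≡⟨ ℕₚ.+-assoc (𝟙 (suc t ℕ.≤ᵇ g)) _ _ ⟩
  𝟙 (suc t ℕ.≤ᵇ g) ℕ.+ (𝟙 (g ℕ.≡ᵇ t) ℕ.+ S)                              ≡⟨ ≡.cong (𝟙 (suc t ℕ.≤ᵇ g) ℕ.+_) (ℕₚ.+-comm _ S) ⟩
  𝟙 (suc t ℕ.≤ᵇ g) ℕ.+ sum< (suc t) (λ e → 𝟙 (g ℕ.≡ᵇ e))               ∎
  where
  open ≡.≡-Reasoning
  S = sum< t (λ e → 𝟙 (g ℕ.≡ᵇ e))

sum<-𝟙-single : ∀ N v₀ (Q : ℕ → Bool) → (Q v₀ ≡ true → v₀ < N) →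
                sum< N (λ v → 𝟙 ((v ℕ.≡ᵇ v₀) ∧ Q v)) ≡ 𝟙 (Q v₀)
sum<-𝟙-single zero    v₀ Q v₀<N with Q v₀ in Qv₀
... | true  = ⊥-elim (ℕₚ.n≮0 (v₀<N refl))
... | false = refl
sum<-𝟙-single (suc N) v₀ Q v₀<N with N ℕ.≡ᵇ v₀ in N≡ᵇv₀
... | true rewrite ≡ᵇ≡true⇒≡ {N} {v₀} N≡ᵇv₀ =
  ≡.cong (ℕ._+ 𝟙 (Q v₀)) (sum<-zero< v₀ _ (λ v v<v₀ → ≡.cong (λ x → 𝟙 (x ∧ Q v)) (≢⇒≡ᵇ≡false (ℕₚ.<⇒≢ v<v₀))))
... | false = ≡.trans (ℕₚ.+-identityʳ _)
  (sum<-𝟙-single N v₀ Q (λ Qv₀ → ℕₚ.≤∧≢⇒< (ℕₚ.≤-pred (v₀<N Qv₀)) (λ v₀≡N → ≡ᵇ≡false⇒≢ N≡ᵇv₀ (≡.sym v₀≡N))))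

∑-apply : ∀ {c ℓ} (R : SemiringWithoutOne c ℓ) n F m →
          Convolution.∑ (Convolution.seriesSemiringWithoutOne R) n F m ≡ Convolution.∑ R n (λ i → F i m)
∑-apply R zero    F m = refl
∑-apply R (suc n) F m = ≡.cong (λ s → SemiringWithoutOne._+_ R s (F (suc n) m)) (∑-apply R n F m)

-- Ser is ℤ[[q]][[u]][[x]]; ⊛≗⋆ identifies its convolution product with ⊛, which
-- transports the semiring laws to ⊛.
ℤ-semiringWithoutOne ℤ[[q]] ℤ[[u,q]] ℤ[[x,u,q]] : SemiringWithoutOne 0ℓ 0ℓ
ℤ-semiringWithoutOne = Semiring.semiringWithoutOne ℤₚ.+-*-semiring
ℤ[[q]]     = Convolution.seriesSemiringWithoutOne ℤ-semiringWithoutOne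
ℤ[[u,q]]   = Convolution.seriesSemiringWithoutOne ℤ[[q]]
ℤ[[x,u,q]] = Convolution.seriesSemiringWithoutOne ℤ[[u,q]]

∑-sumTo : ∀ n f → Convolution.∑ ℤ-semiringWithoutOne n f ≡ sumTo n f
∑-sumTo zero    f = refl
∑-sumTo (suc n) f = ≡.cong (ℤ._+ f (suc n)) (∑-sumTo n f)

open SemiringWithoutOne ℤ[[x,u,q]] using ()
  renaming (_*_ to _⋆_; _≈_ to _≈₃_; *-cong to ⋆-cong; *-assoc to ⋆-assoc; distribˡ to ⋆-distribˡ-⊕;
            distribʳ to ⋆-distribʳ-⊕; zeroˡ to ⋆-zeroˡ)

⊛≗⋆ : ∀ f g n a c → (f ⊛ g) n a c ≡ (f ⋆ g) n a c
⊛≗⋆ f g n a c = ≡.sym (begin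
  (f ⋆ g) n a c
    ≡⟨ ≡.cong (_$ c) (∑-apply ℤ[[q]] n _ a) ⟩
  Convolution.∑ ℤ[[q]] n (λ i → (f i *₂ g (n ∸ i)) a) c
    ≡⟨ ∑-apply ℤ-semiringWithoutOne n _ c ⟩
  Convolution.∑ ℤ-semiringWithoutOne n (λ i → (f i *₂ g (n ∸ i)) a c)
    ≡⟨ ∑-sumTo n _ ⟩
  sumTo n (λ i → (f i *₂ g (n ∸ i)) a c)
    ≡⟨ sumTo-cong n (λ i → coefficient₂ (f i) (g (n ∸ i))) ⟩
  (f ⊛ g) n a c ∎)
  where
  open ≡.≡-Reasoning
  open SemiringWithoutOne ℤ[[u,q]] using () renaming (_*_ to _*₂_)
  open SemiringWithoutOne ℤ[[q]] using () renaming (_*_ to _*₁_)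
  coefficient₂ : ∀ x y → (x *₂ y) a c ≡ sumTo a (λ j → sumTo c (λ l → x j l ℤ.* y (a ∸ j) (c ∸ l)))
  coefficient₂ x y = ≡.trans (∑-apply ℤ-semiringWithoutOne a _ c)
    (≡.trans (∑-sumTo a _) (sumTo-cong a (λ j → ∑-sumTo c _)))

-- A record rather than a Π-type, so that f and g can be inferred from a proof.
infix 4 _≐_
record _≐_ (f g : Ser) : Set where
  constructor coefficientwise
  field coeff : ∀ n a c → f n a c ≡ g n a c
open _≐_ public

≐-setoid : Setoid 0ℓ 0ℓ
≐-setoid = record
  { Carrier = Ser
  ; _≈_ = _≐_
  ; isEquivalence = record
    { refl  = coefficientwise λ _ _ _ → refl
    ; sym   = λ p → coefficientwise λ n a c → ≡.sym (coeff p n a c)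
    ; trans = λ p q → coefficientwise λ n a c → ≡.trans (coeff p n a c) (coeff q n a c)
    }
  }

open Setoid ≐-setoid public using () renaming (refl to ≐-refl; sym to ≐-sym; trans to ≐-trans)
module ≐-Reasoning = Relation.Binary.Reasoning.Setoid ≐-setoid

≈₃⇒≐ : ∀ {f g} → f ≈₃ g → f ≐ g
≈₃⇒≐ f≈g = coefficientwise f≈g

⊛≐⋆ : ∀ f g → f ⊛ g ≐ f ⋆ g
⊛≐⋆ f g = coefficientwise (⊛≗⋆ f g)

⊛-cong : ∀ {f f′ g g′} → f ≐ f′ → g ≐ g′ → f ⊛ g ≐ f′ ⊛ g′
⊛-cong {f} {f′} {g} {g′} f≐f′ g≐g′ = begin
  f ⊛ g    ≈⟨ ⊛≐⋆ f g ⟩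
  f ⋆ g    ≈⟨ ≈₃⇒≐ (⋆-cong {f} {f′} {g} {g′} (coeff f≐f′) (coeff g≐g′)) ⟩
  f′ ⋆ g′  ≈⟨ ⊛≐⋆ f′ g′ ⟨
  f′ ⊛ g′  ∎
  where open ≐-Reasoning

⊛-congˡ : ∀ f {g g′} → g ≐ g′ → f ⊛ g ≐ f ⊛ g′
⊛-congˡ f = ⊛-cong (≐-refl {f})

⊛-assoc : ∀ f g h → (f ⊛ g) ⊛ h ≐ f ⊛ (g ⊛ h)
⊛-assoc f g h = begin
  (f ⊛ g) ⊛ h  ≈⟨ ⊛≐⋆ (f ⊛ g) h ⟩
  (f ⊛ g) ⋆ h  ≈⟨ ≈₃⇒≐ (⋆-cong {f ⊛ g} {f ⋆ g} {h} {h} (⊛≗⋆ f g) (λ _ _ _ → refl)) ⟩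
  (f ⋆ g) ⋆ h  ≈⟨ ≈₃⇒≐ (⋆-assoc f g h) ⟩
  f ⋆ (g ⋆ h)  ≈⟨ ≈₃⇒≐ (⋆-cong {f} {f} {g ⋆ h} {g ⊛ h} (λ _ _ _ → refl) (λ n a c → ≡.sym (⊛≗⋆ g h n a c))) ⟩
  f ⋆ (g ⊛ h)  ≈⟨ ⊛≐⋆ f (g ⊛ h) ⟨
  f ⊛ (g ⊛ h)  ∎
  where open ≐-Reasoning

⊛-distribˡ-⊕ : ∀ f g h → f ⊛ (g ⊕ h) ≐ (f ⊛ g) ⊕ (f ⊛ h)
⊛-distribˡ-⊕ f g h = coefficientwise λ n a c →
  ≡.trans (⊛≗⋆ f (g ⊕ h) n a c) (≡.trans (⋆-distribˡ-⊕ f g h n a c)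
    (≡.sym (≡.cong₂ ℤ._+_ (⊛≗⋆ f g n a c) (⊛≗⋆ f h n a c))))

⊛-distribʳ-⊕ : ∀ f g h → (g ⊕ h) ⊛ f ≐ (g ⊛ f) ⊕ (h ⊛ f)
⊛-distribʳ-⊕ f g h = coefficientwise λ n a c →
  ≡.trans (⊛≗⋆ (g ⊕ h) f n a c) (≡.trans (⋆-distribʳ-⊕ f g h n a c)
    (≡.sym (≡.cong₂ ℤ._+_ (⊛≗⋆ g f n a c) (⊛≗⋆ h f n a c))))

⊛-zeroˡ : ∀ f → zeroS ⊛ f ≐ zeroS
⊛-zeroˡ f = coefficientwise λ n a c → ≡.trans (⊛≗⋆ zeroS f n a c) (⋆-zeroˡ f n a c)

⊕-cong : ∀ {f f′ g g′} → f ≐ f′ → g ≐ g′ → f ⊕ g ≐ f′ ⊕ g′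
⊕-cong f≐f′ g≐g′ = coefficientwise λ n a c → ≡.cong₂ ℤ._+_ (coeff f≐f′ n a c) (coeff g≐g′ n a c)

⊕-congˡ : ∀ f {g g′} → g ≐ g′ → f ⊕ g ≐ f ⊕ g′
⊕-congˡ f = ⊕-cong (≐-refl {f})

⊛-identityˡ : ∀ f → oneS ⊛ f ≐ f
⊛-identityˡ f = coefficientwise λ n a c →
  ≡.trans (sumTo-head n _ (λ i → sumTo-zero a _ (λ j → sumTo-zero c _ (λ l → refl))))
  (≡.trans (sumTo-head a _ (λ j → sumTo-zero c _ (λ l → refl)))
  (≡.trans (sumTo-head c _ (λ l → refl)) (ℤₚ.*-identityˡ (f n a c))))


sum4-cong : ∀ {F H : Fin 4 → Ser} → (∀ k → F k ≐ H k) → sum4 F ≐ sum4 H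
sum4-cong F≐H = ⊕-cong (F≐H i0) (⊕-cong (F≐H i1) (⊕-cong (F≐H i2) (F≐H i3)))

⊛-distribʳ-sum4 : ∀ (F : Fin 4 → Ser) g → sum4 F ⊛ g ≐ sum4 (λ k → F k ⊛ g)
⊛-distribʳ-sum4 F g = begin
  sum4 F ⊛ g
    ≈⟨ ⊛-distribʳ-⊕ g (F i0) (F i1 ⊕ (F i2 ⊕ F i3)) ⟩
  (F i0 ⊛ g) ⊕ ((F i1 ⊕ (F i2 ⊕ F i3)) ⊛ g)
    ≈⟨ ⊕-congˡ (F i0 ⊛ g) (⊛-distribʳ-⊕ g (F i1) (F i2 ⊕ F i3)) ⟩
  (F i0 ⊛ g) ⊕ ((F i1 ⊛ g) ⊕ ((F i2 ⊕ F i3) ⊛ g))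
    ≈⟨ ⊕-congˡ (F i0 ⊛ g) (⊕-congˡ (F i1 ⊛ g) (⊛-distribʳ-⊕ g (F i2) (F i3))) ⟩
  sum4 (λ k → F k ⊛ g) ∎
  where open ≐-Reasoning

⊛-distribˡ-sum4 : ∀ (F : Fin 4 → Ser) g → g ⊛ sum4 F ≐ sum4 (λ k → g ⊛ F k)
⊛-distribˡ-sum4 F g = begin
  g ⊛ sum4 F
    ≈⟨ ⊛-distribˡ-⊕ g (F i0) (F i1 ⊕ (F i2 ⊕ F i3)) ⟩
  (g ⊛ F i0) ⊕ (g ⊛ (F i1 ⊕ (F i2 ⊕ F i3)))
    ≈⟨ ⊕-congˡ (g ⊛ F i0) (⊛-distribˡ-⊕ g (F i1) (F i2 ⊕ F i3)) ⟩
  (g ⊛ F i0) ⊕ ((g ⊛ F i1) ⊕ (g ⊛ (F i2 ⊕ F i3)))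
    ≈⟨ ⊕-congˡ (g ⊛ F i0) (⊕-congˡ (g ⊛ F i1) (⊛-distribˡ-⊕ g (F i2) (F i3))) ⟩
  sum4 (λ k → g ⊛ F k) ∎
  where open ≐-Reasoning

sum4-distrib-⊕ : ∀ (F H : Fin 4 → Ser) → sum4 (λ k → F k ⊕ H k) ≐ sum4 F ⊕ sum4 H
sum4-distrib-⊕ F H = coefficientwise λ n a c →
  solve 8 (λ a₀ a₁ a₂ a₃ b₀ b₁ b₂ b₃ →
             (a₀ :+ b₀) :+ ((a₁ :+ b₁) :+ ((a₂ :+ b₂) :+ (a₃ :+ b₃)))
          := (a₀ :+ (a₁ :+ (a₂ :+ a₃))) :+ (b₀ :+ (b₁ :+ (b₂ :+ b₃))))
    refl (F i0 n a c) (F i1 n a c) (F i2 n a c) (F i3 n a c) (H i0 n a c) (H i1 n a c) (H i2 n a c) (H i3 n a c)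
  where open ℤ-Solver

sum4-comm : ∀ (Y : Fin 4 → Fin 4 → Ser) → sum4 (λ k → sum4 (λ m → Y m k)) ≐ sum4 (λ m → sum4 (λ k → Y m k))
sum4-comm Y = ≐-sym (begin
  sum4 (λ m → sum4 (Y m))
    ≈⟨ sum4-distrib-⊕ (λ m → Y m i0) (λ m → Y m i1 ⊕ (Y m i2 ⊕ Y m i3)) ⟩
  sum4 (λ m → Y m i0) ⊕ sum4 (λ m → Y m i1 ⊕ (Y m i2 ⊕ Y m i3))
    ≈⟨ ⊕-congˡ (sum4 (λ m → Y m i0)) (sum4-distrib-⊕ (λ m → Y m i1) (λ m → Y m i2 ⊕ Y m i3)) ⟩
  sum4 (λ m → Y m i0) ⊕ (sum4 (λ m → Y m i1) ⊕ sum4 (λ m → Y m i2 ⊕ Y m i3))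
    ≈⟨ ⊕-congˡ (sum4 (λ m → Y m i0)) (⊕-congˡ (sum4 (λ m → Y m i1)) (sum4-distrib-⊕ (λ m → Y m i2) (λ m → Y m i3))) ⟩
  sum4 (λ k → sum4 (λ m → Y m k)) ∎)
  where open ≐-Reasoning

▸-congʳ : ∀ A {u v : Vec4} → (∀ r → u r ≐ v r) → ∀ i → (A ▸ u) i ≐ (A ▸ v) i
▸-congʳ A u≐v i = sum4-cong (λ k → ⊛-congˡ (A i k) (u≐v k))

▸-distrib-⊕ : ∀ A (u v : Vec4) i → (A ▸ (λ r → u r ⊕ v r)) i ≐ (A ▸ u) i ⊕ (A ▸ v) i
▸-distrib-⊕ A u v i =
  ≐-trans (sum4-cong (λ k → ⊛-distribˡ-⊕ (A i k) (u k) (v k))) (sum4-distrib-⊕ (λ k → A i k ⊛ u k) (λ k → A i k ⊛ v k))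

·-▸-assoc : ∀ A B (v : Vec4) i → ((A · B) ▸ v) i ≐ (A ▸ (B ▸ v)) i
·-▸-assoc A B v i = begin
  sum4 (λ k → sum4 (λ m → A i m ⊛ B m k) ⊛ v k)
    ≈⟨ sum4-cong (λ k → ⊛-distribʳ-sum4 (λ m → A i m ⊛ B m k) (v k)) ⟩
  sum4 (λ k → sum4 (λ m → (A i m ⊛ B m k) ⊛ v k))
    ≈⟨ sum4-cong (λ k → sum4-cong (λ m → ⊛-assoc (A i m) (B m k) (v k))) ⟩
  sum4 (λ k → sum4 (λ m → A i m ⊛ (B m k ⊛ v k)))
    ≈⟨ sum4-comm (λ m k → A i m ⊛ (B m k ⊛ v k)) ⟩
  sum4 (λ m → sum4 (λ k → A i m ⊛ (B m k ⊛ v k)))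
    ≈⟨ sum4-cong (λ m → ⊛-distribˡ-sum4 (λ k → B m k ⊛ v k) (A i m)) ⟨
  sum4 (λ m → A i m ⊛ sum4 (λ k → B m k ⊛ v k)) ∎
  where open ≐-Reasoning

I-▸ : ∀ (v : Vec4) i → (I ▸ v) i ≐ v i
I-▸ v zero = ≐-trans
  (⊕-cong (⊛-identityˡ (v i0)) (⊕-cong (⊛-zeroˡ (v i1)) (⊕-cong (⊛-zeroˡ (v i2)) (⊛-zeroˡ (v i3)))))
  (coefficientwise λ _ _ _ → ℤₚ.+-identityʳ _)
I-▸ v (suc zero) = ≐-trans
  (⊕-cong (⊛-zeroˡ (v i0)) (⊕-cong (⊛-identityˡ (v i1)) (⊕-cong (⊛-zeroˡ (v i2)) (⊛-zeroˡ (v i3)))))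
  (coefficientwise λ _ _ _ → ≡.trans (ℤₚ.+-identityˡ _) (ℤₚ.+-identityʳ _))
I-▸ v (suc (suc zero)) = ≐-trans
  (⊕-cong (⊛-zeroˡ (v i0)) (⊕-cong (⊛-zeroˡ (v i1)) (⊕-cong (⊛-identityˡ (v i2)) (⊛-zeroˡ (v i3)))))
  (coefficientwise λ _ _ _ → ≡.trans (ℤₚ.+-identityˡ _) (≡.trans (ℤₚ.+-identityˡ _) (ℤₚ.+-identityʳ _)))
I-▸ v (suc (suc (suc zero))) = ≐-trans
  (⊕-cong (⊛-zeroˡ (v i0)) (⊕-cong (⊛-zeroˡ (v i1)) (⊕-cong (⊛-zeroˡ (v i2)) (⊛-identityˡ (v i3)))))
  (coefficientwise λ _ _ _ → ≡.trans (ℤₚ.+-identityˡ _) (≡.trans (ℤₚ.+-identityˡ _) (ℤₚ.+-identityˡ _)))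

-- Divisibility by powers of x

infix 4 x^_∣_
x^_∣_ : ℕ → Ser → Set
x^ d ∣ f = ∀ n → n < d → ∀ a c → f n a c ≡ 0ℤ

x^-∣-weaken : ∀ {d e f} → e ≤ d → x^ d ∣ f → x^ e ∣ f
x^-∣-weaken e≤d x^d∣f n n<e = x^d∣f n (ℕₚ.<-≤-trans n<e e≤d)

x^0∣ : ∀ f → x^ 0 ∣ f
x^0∣ f n ()

x^-∣-zeroS : ∀ d → x^ d ∣ zeroS
x^-∣-zeroS d n _ a c = refl

x^-∣-⊛ : ∀ d e {f g} → x^ d ∣ f → x^ e ∣ g → x^ (d ℕ.+ e) ∣ f ⊛ g
x^-∣-⊛ d e {f} {g} x^d∣f x^e∣g n n<d+e a c =
  sumTo-zero≤ n _ λ i i≤n → sumTo-zero a _ λ j → sumTo-zero c _ λ l → vanishes i i≤n j l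
  where
  n∸i<e : ∀ {i} → i ≤ n → d ≤ i → n ∸ i < e
  n∸i<e i≤n d≤i = ℕₚ.≤-<-trans (ℕₚ.∸-monoʳ-≤ n d≤i)
    (≡.subst (n ∸ d <_) (ℕₚ.m+n∸m≡n d e) (ℕₚ.∸-monoˡ-< n<d+e (ℕₚ.≤-trans d≤i i≤n)))
  vanishes : ∀ i → i ≤ n → ∀ j l → f i j l ℤ.* g (n ∸ i) (a ∸ j) (c ∸ l) ≡ 0ℤ
  vanishes i i≤n j l with d ℕₚ.≤? i
  ... | no d≰i rewrite x^d∣f i (ℕₚ.≰⇒> d≰i) j l = refl
  ... | yes d≤i rewrite x^e∣g (n ∸ i) (n∸i<e i≤n d≤i) (a ∸ j) (c ∸ l) = ℤₚ.*-zeroʳ (f i j l)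

x^-∣-substU : ∀ {d f} k → x^ d ∣ f → x^ d ∣ substU k f
x^-∣-substU k x^d∣f n n<d a c with k ℕ.* a ℕ.≤ᵇ c
... | true  = x^d∣f n n<d a (c ∸ k ℕ.* a)
... | false = refl

x^-∣-sum4 : ∀ {d} (F : Fin 4 → Ser) → (∀ k → x^ d ∣ F k) → x^ d ∣ sum4 F
x^-∣-sum4 F x^d∣F n n<d a c
  rewrite x^d∣F i0 n n<d a c | x^d∣F i1 n n<d a c | x^d∣F i2 n n<d a c | x^d∣F i3 n n<d a c = refl

x∣mono : ∀ a c → x^ 1 ∣ mono 1 a c
x∣mono a c .0 (s≤s z≤n) a′ c′ = refl

x∣frac : ∀ a c → x^ 1 ∣ frac a c
x∣frac a c = x^-∣-⊛ 1 0 (x∣mono a c) (x^0∣ invQU)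

x∣G : ∀ s → x^ 1 ∣ G s
x∣G s .0 (s≤s z≤n) a c = refl

x∣G1 : ∀ s → x^ 1 ∣ G1 s
x∣G1 s .0 (s≤s z≤n) zero    c = refl
x∣G1 s .0 (s≤s z≤n) (suc e) c = refl

x∣M : ∀ r s → x^ 1 ∣ M r s
x∣M zero                   zero                   = x^-∣-zeroS 1
x∣M zero                   (suc zero)             = x^-∣-zeroS 1
x∣M zero                   (suc (suc zero))       = x∣frac 1 1
x∣M zero                   (suc (suc (suc zero))) = x∣frac 1 1
x∣M (suc zero)             zero                   = x^-∣-zeroS 1
x∣M (suc zero)             (suc zero)             = x^-∣-zeroS 1
x∣M (suc zero)             (suc (suc zero))       = x∣frac 2 1
x∣M (suc zero)             (suc (suc (suc zero))) = x∣frac 1 0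
x∣M (suc (suc zero))       zero                   = x∣frac 1 1
x∣M (suc (suc zero))       (suc zero)             = x∣frac 1 1
x∣M (suc (suc zero))       (suc (suc zero))       = x^-∣-zeroS 1
x∣M (suc (suc zero))       (suc (suc (suc zero))) = x^-∣-zeroS 1
x∣M (suc (suc (suc zero))) zero                   = x∣frac 2 2
x∣M (suc (suc (suc zero))) (suc zero)             = x∣frac 1 1
x∣M (suc (suc (suc zero))) (suc (suc zero))       = x^-∣-zeroS 1
x∣M (suc (suc (suc zero))) (suc (suc (suc zero))) = x^-∣-zeroS 1

x∣N : ∀ r s → x^ 1 ∣ N r s
x∣N zero                   zero                   = x^-∣-zeroS 1
x∣N zero                   (suc zero)             = x^-∣-zeroS 1
x∣N zero                   (suc (suc zero))       = x∣frac 1 1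
x∣N zero                   (suc (suc (suc zero))) = x∣frac 1 1
x∣N (suc zero)             zero                   = x^-∣-zeroS 1
x∣N (suc zero)             (suc zero)             = x^-∣-zeroS 1
x∣N (suc zero)             (suc (suc zero))       = x∣frac 1 0
x∣N (suc zero)             (suc (suc (suc zero))) = x∣frac 1 0
x∣N (suc (suc zero))       zero                   = x∣frac 1 1
x∣N (suc (suc zero))       (suc zero)             = x∣frac 1 1
x∣N (suc (suc zero))       (suc (suc zero))       = x^-∣-zeroS 1
x∣N (suc (suc zero))       (suc (suc (suc zero))) = x^-∣-zeroS 1
x∣N (suc (suc (suc zero))) zero                   = x∣frac 1 1
x∣N (suc (suc (suc zero))) (suc zero)             = x∣frac 1 1
x∣N (suc (suc (suc zero))) (suc (suc zero))       = x^-∣-zeroS 1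
x∣N (suc (suc (suc zero))) (suc (suc (suc zero))) = x^-∣-zeroS 1

x∣B : ∀ r → x^ 1 ∣ B r
x∣B zero                   = x^-∣-zeroS 1
x∣B (suc zero)             = x^-∣-zeroS 1
x∣B (suc (suc zero))       = x^-∣-zeroS 1
x∣B (suc (suc (suc zero))) = x∣mono 1 1

x^k∣P : ∀ k i j → x^ k ∣ P k i j
x^k∣P zero    i j = x^0∣ (P 0 i j)
x^k∣P (suc k) i j = x^-∣-weaken (ℕₚ.≤-reflexive (ℕₚ.+-comm 1 k))
  (x^-∣-sum4 _ (λ m → x^-∣-⊛ k 1 (x^k∣P k i m) (x^-∣-substU k (x∣M m j))))

Gq : ℕ → Vec4
Gq k s = substU k (G s)

Bq⊖NqG1 : ℕ → Vec4
Bq⊖NqG1 k r = Bq k r ⊖ (Nq k ▸ G1) r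

x∣Bq⊖NqG1 : ∀ k r → x^ 1 ∣ Bq⊖NqG1 k r
x∣Bq⊖NqG1 k r n n<1 a c
  rewrite x^-∣-substU k (x∣B r) n n<1 a c
        | x^-∣-sum4 (λ s → Nq k r s ⊛ G1 s) (λ s → x^-∣-⊛ 1 0 (x^-∣-substU k (x∣N r s)) (x^0∣ (G1 s))) n n<1 a c
        = refl

x^k+1∣term : ∀ k i → x^ (k ℕ.+ 1) ∣ term k i
x^k+1∣term k i = x^-∣-sum4 _ (λ m → x^-∣-⊛ k 1 (x^k∣P k i m) (x∣Bq⊖NqG1 k m))

x^k+1∣P▸Gq : ∀ k i → x^ (k ℕ.+ 1) ∣ (P k ▸ Gq k) i
x^k+1∣P▸Gq k i = x^-∣-sum4 _ (λ m → x^-∣-⊛ k 1 (x^k∣P k i m) (x^-∣-substU k (x∣G m)))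

-- Iterating the functional equation

FunctionalEquation : Set
FunctionalEquation = ∀ k i → Gq k i ≐ (Mq k ▸ Gq (suc k)) i ⊕ Bq⊖NqG1 k i

partialSum : ℕ → Vec4
partialSum zero    i = zeroS
partialSum (suc K) i = partialSum K i ⊕ term K i

partialSum-coeff : ∀ K i n a c → partialSum (suc K) i n a c ≡ sumTo K (λ k → term k i n a c)
partialSum-coeff zero    i n a c = ℤₚ.+-identityˡ _
partialSum-coeff (suc K) i n a c = ≡.cong (ℤ._+ term (suc K) i n a c) (partialSum-coeff K i n a c)

module Iteration (functionalEquation : FunctionalEquation) where

  G-expansion : ∀ K i → G i ≐ partialSum K i ⊕ (P K ▸ Gq K) i
  G-expansion zero    i = coefficientwise λ n a c → ≡.sym (≡.trans (ℤₚ.+-identityˡ _) (coeff (I-▸ (Gq 0) i) n a c))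
  G-expansion (suc K) i = begin
    G i
      ≈⟨ G-expansion K i ⟩
    partialSum K i ⊕ (P K ▸ Gq K) i
      ≈⟨ ⊕-congˡ (partialSum K i) (▸-congʳ (P K) (functionalEquation K) i) ⟩
    partialSum K i ⊕ (P K ▸ (λ r → (Mq K ▸ Gq (suc K)) r ⊕ Bq⊖NqG1 K r)) i
      ≈⟨ ⊕-congˡ (partialSum K i) (▸-distrib-⊕ (P K) (Mq K ▸ Gq (suc K)) (Bq⊖NqG1 K) i) ⟩
    partialSum K i ⊕ ((P K ▸ (Mq K ▸ Gq (suc K))) i ⊕ term K i)
      ≈⟨ ⊕-congˡ (partialSum K i) (⊕-cong (·-▸-assoc (P K) (Mq K) (Gq (suc K)) i) ≐-refl) ⟨
    partialSum K i ⊕ ((P (suc K) ▸ Gq (suc K)) i ⊕ term K i)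
      ≈⟨ coefficientwise (λ n a c → solve 3 (λ x y z → x :+ (y :+ z) := (x :+ z) :+ y) refl
           (partialSum K i n a c) ((P (suc K) ▸ Gq (suc K)) i n a c) (term K i n a c)) ⟩
    partialSum (suc K) i ⊕ (P (suc K) ▸ Gq (suc K)) i ∎
    where
    open ≐-Reasoning
    open ℤ-Solver

  G-coeff : ∀ i n a c → G i n a c ≡ sumTo n (λ k → term k i n a c)
  G-coeff i n a c = begin
    G i n a c
      ≡⟨ coeff (G-expansion (suc n) i) n a c ⟩
    partialSum (suc n) i n a c ℤ.+ (P (suc n) ▸ Gq (suc n)) i n a c
      ≡⟨ ≡.cong (ℤ._+_ (partialSum (suc n) i n a c)) (x^k+1∣P▸Gq (suc n) i n (ℕₚ.m≤m+n (suc n) 1) a c) ⟩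
    partialSum (suc n) i n a c ℤ.+ 0ℤ
      ≡⟨ ℤₚ.+-identityʳ _ ⟩
    partialSum (suc n) i n a c
      ≡⟨ partialSum-coeff n i n a c ⟩
    sumTo n (λ k → term k i n a c) ∎
    where open ≡.≡-Reasoning

mono-⊛ : ∀ d α β f n j l →
         (mono d α β ⊛ f) n j l
           ≡ (if d ℕ.≤ᵇ n then (if α ℕ.≤ᵇ j then (if β ℕ.≤ᵇ l then f (n ∸ d) (j ∸ α) (l ∸ β) else 0ℤ) else 0ℤ) else 0ℤ)
mono-⊛ d α β f n j l =
  ≡.trans (sumTo-single n d _ (λ i d≢i → sumTo-zero j _ (λ q → sumTo-zero l _ (λ r → off-x d≢i q r))))
    (≡.cong (λ s → if d ℕ.≤ᵇ n then s else 0ℤ)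
      (≡.trans (sumTo-single j α _ (λ q α≢q → sumTo-zero l _ (λ r → off-u α≢q r)))
        (≡.cong (λ s → if α ℕ.≤ᵇ j then s else 0ℤ)
          (≡.trans (sumTo-single l β _ (λ r β≢r → off-q β≢r))
            (≡.cong (λ s → if β ℕ.≤ᵇ l then s else 0ℤ) at-monomial)))))
  where
  f′ : ℕ → ℕ → ℕ → ℤ
  f′ i q r = f (n ∸ i) (j ∸ q) (l ∸ r)
  off-x : ∀ {i} → (d ℕ.≡ᵇ i) ≡ false → ∀ q r → mono d α β i q r ℤ.* f′ i q r ≡ 0ℤ
  off-x d≢i q r rewrite d≢i = refl
  off-u : ∀ {q} → (α ℕ.≡ᵇ q) ≡ false → ∀ r → mono d α β d q r ℤ.* f′ d q r ≡ 0ℤ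
  off-u α≢q r rewrite ≡ᵇ-refl d | α≢q = refl
  off-q : ∀ {r} → (β ℕ.≡ᵇ r) ≡ false → mono d α β d α r ℤ.* f′ d α r ≡ 0ℤ
  off-q β≢r rewrite ≡ᵇ-refl d | ≡ᵇ-refl α | β≢r = refl
  at-monomial : mono d α β d α β ℤ.* f′ d α β ≡ f′ d α β
  at-monomial rewrite ≡ᵇ-refl d | ≡ᵇ-refl α | ≡ᵇ-refl β = ℤₚ.*-identityˡ _

-- x u^α q^β / (qu − 1) = −Σ_(j ≥ α) x u^j q^(β + j − α); after u ↦ q^K u its u^j term
-- has q-exponent qExp K α β j.
qExp : ℕ → ℕ → ℕ → ℕ → ℕ
qExp K α β j = K ℕ.* j ℕ.+ (β ℕ.+ (j ∸ α))

substU-frac : ∀ K α β i j l →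
  substU K (frac α β) i j l ≡ (if (1 ℕ.≡ᵇ i) ∧ (α ℕ.≤ᵇ j) ∧ (qExp K α β j ℕ.≡ᵇ l) then -1ℤ else 0ℤ)
substU-frac K α β i j l
  rewrite mono-⊛ 1 α β invQU i j (l ∸ K ℕ.* j)
        | +-≡ᵇ′ (K ℕ.* j) (β ℕ.+ (j ∸ α)) l
        | +-≡ᵇ′ β (j ∸ α) (l ∸ K ℕ.* j)
        = shape i (K ℕ.* j ℕ.≤ᵇ l) (α ℕ.≤ᵇ j) (β ℕ.≤ᵇ l ∸ K ℕ.* j)
  where
  x y : ℕ
  x = j ∸ α
  y = l ∸ K ℕ.* j ∸ β
  shape : ∀ i a b c →
    (if a then (if 1 ℕ.≤ᵇ i then (if b then (if c then invQU (i ∸ 1) x y else 0ℤ) else 0ℤ) else 0ℤ) else 0ℤ)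
      ≡ (if (1 ℕ.≡ᵇ i) ∧ b ∧ a ∧ c ∧ (x ℕ.≡ᵇ y) then -1ℤ else 0ℤ)
  shape zero                a     b     c     = if-const a
  shape (suc zero)          true  true  true  = refl
  shape (suc zero)          true  true  false = refl
  shape (suc zero)          true  false c     = refl
  shape (suc zero)          false true  c     = refl
  shape (suc zero)          false false c     = refl
  shape (suc (suc i))       true  true  c     = if-const c
  shape (suc (suc i))       true  false c     = refl
  shape (suc (suc i))       false b     c     = refl

substU-frac-⊛ : ∀ K α β h n a c →
  (substU K (frac α β) ⊛ h) (suc n) a c
    ≡ ℤ.- sumTo a (λ j → if (α ℕ.≤ᵇ j) ∧ (qExp K α β j ℕ.≤ᵇ c) then h n (a ∸ j) (c ∸ qExp K α β j) else 0ℤ)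
substU-frac-⊛ K α β h n a c = begin
  (substU K (frac α β) ⊛ h) (suc n) a c
    ≡⟨ sumTo-single (suc n) 1 _ (λ i 1≢i → sumTo-zero a _ λ j → sumTo-zero c _ λ l → off-x {i} 1≢i j l) ⟩
  sumTo a (λ j → sumTo c (λ l → S 1 j l ℤ.* h n (a ∸ j) (c ∸ l)))
    ≡⟨ sumTo-cong a (λ j → sumTo-single c (qExp K α β j) _ (off-q j)) ⟩
  sumTo a (λ j → if qExp K α β j ℕ.≤ᵇ c then S 1 j (qExp K α β j) ℤ.* h n (a ∸ j) (c ∸ qExp K α β j) else 0ℤ)
    ≡⟨ sumTo-cong a at-qExp ⟩
  sumTo a (λ j → ℤ.- (if (α ℕ.≤ᵇ j) ∧ (qExp K α β j ℕ.≤ᵇ c) then h n (a ∸ j) (c ∸ qExp K α β j) else 0ℤ))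
    ≡⟨ sumTo-neg a _ ⟩
  ℤ.- sumTo a (λ j → if (α ℕ.≤ᵇ j) ∧ (qExp K α β j ℕ.≤ᵇ c) then h n (a ∸ j) (c ∸ qExp K α β j) else 0ℤ) ∎
  where
  open ≡.≡-Reasoning
  S : ℕ → ℕ → ℕ → ℤ
  S = substU K (frac α β)
  off-x : ∀ {i} → (1 ℕ.≡ᵇ i) ≡ false → ∀ j l → S i j l ℤ.* h (suc n ∸ i) (a ∸ j) (c ∸ l) ≡ 0ℤ
  off-x {i} 1≢i j l rewrite substU-frac K α β i j l | 1≢i = refl
  off-q : ∀ j l → (qExp K α β j ℕ.≡ᵇ l) ≡ false → S 1 j l ℤ.* h n (a ∸ j) (c ∸ l) ≡ 0ℤ
  off-q j l q≢l rewrite substU-frac K α β 1 j l | q≢l | ∧-zeroʳ (α ℕ.≤ᵇ j) = refl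
  at-qExp : ∀ j →
    (if qExp K α β j ℕ.≤ᵇ c then S 1 j (qExp K α β j) ℤ.* h n (a ∸ j) (c ∸ qExp K α β j) else 0ℤ)
      ≡ ℤ.- (if (α ℕ.≤ᵇ j) ∧ (qExp K α β j ℕ.≤ᵇ c) then h n (a ∸ j) (c ∸ qExp K α β j) else 0ℤ)
  at-qExp j rewrite substU-frac K α β 1 j (qExp K α β j) | ≡ᵇ-refl (qExp K α β j) | ∧-identityʳ (α ℕ.≤ᵇ j)
    with α ℕ.≤ᵇ j | qExp K α β j ℕ.≤ᵇ c
  ... | true  | true  = ℤₚ.-1*i≡-i _
  ... | true  | false = refl
  ... | false | true  = refl
  ... | false | false = refl

qExp-shift : ∀ K α β {j a} → α ≤ j → j ≤ a → qExp K α β j ℕ.+ suc K ℕ.* (a ∸ j) ≡ qExp K α β a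
qExp-shift K α β {j} {a} α≤j j≤a = begin
  K ℕ.* j ℕ.+ (β ℕ.+ (j ∸ α)) ℕ.+ suc K ℕ.* r
    ≡⟨ solve 5 (λ K j β p r → K :* j :+ (β :+ p) :+ (con 1 :+ K) :* r := K :* (j :+ r) :+ (β :+ (p :+ r)))
               refl K j β (j ∸ α) r ⟩
  K ℕ.* (j ℕ.+ r) ℕ.+ (β ℕ.+ (j ∸ α ℕ.+ r))
    ≡⟨ ≡.cong₂ (λ u v → K ℕ.* u ℕ.+ (β ℕ.+ v)) j+r≡a (≡.trans (≡.sym (ℕₚ.+-∸-comm r α≤j)) (≡.cong (_∸ α) j+r≡a)) ⟩
  K ℕ.* a ℕ.+ (β ℕ.+ (a ∸ α)) ∎
  where
  open ≡.≡-Reasoning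
  open ℕ-Solver
  r = a ∸ j
  j+r≡a : j ℕ.+ r ≡ a
  j+r≡a = ℕₚ.m+[n∸m]≡n j≤a

countB-∷ : ∀ {A : Set} (p : A → Bool) x xs → countB p (x ∷ xs) ≡ 𝟙 (p x) ℕ.+ countB p xs
countB-∷ p x xs with p x
... | true  = refl
... | false = refl

module _ {A : Set} (P : A → Bool → Bool) (P-false : ∀ w → P w false ≡ false) (g : A → ℕ) (t : ℕ) where

  𝟙-split-by-value : ∀ w → 𝟙 (P w true) ≡ 𝟙 (P w (t ℕ.≤ᵇ g w)) ℕ.+ sum< t (λ e → 𝟙 (P w (g w ℕ.≡ᵇ e)))
  𝟙-split-by-value w with P w true in P-true
  ... | false = ≡.sym (≡.cong₂ ℕ._+_ (≡.cong 𝟙 (P≡false (t ℕ.≤ᵇ g w)))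
                                    (sum<-zero t _ (λ e → ≡.cong 𝟙 (P≡false (g w ℕ.≡ᵇ e)))))
    where
    P≡false : ∀ b → P w b ≡ false
    P≡false true  = P-true
    P≡false false = P-false w
  ... | true = ≡.trans (𝟙-partition t (g w))
                 (≡.cong₂ ℕ._+_ (≡.cong 𝟙 (≡.sym (P≡id (t ℕ.≤ᵇ g w))))
                                (sum<-cong t (λ e → ≡.cong 𝟙 (≡.sym (P≡id (g w ℕ.≡ᵇ e))))))
    where
    P≡id : ∀ b → P w b ≡ b
    P≡id true  = P-true
    P≡id false = P-false w

  countB-split-by-value : ∀ xs → countB (λ w → P w true) xs
    ≡ countB (λ w → P w (t ℕ.≤ᵇ g w)) xs ℕ.+ sum< t (λ e → countB (λ w → P w (g w ℕ.≡ᵇ e)) xs)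
  countB-split-by-value []       = ≡.sym (sum<-zero t _ (λ e → refl))
  countB-split-by-value (x ∷ xs) = begin
    countB (λ w → P w true) (x ∷ xs)
      ≡⟨ countB-∷ _ x xs ⟩
    𝟙 (P x true) ℕ.+ countB (λ w → P w true) xs
      ≡⟨ ≡.cong₂ ℕ._+_ (𝟙-split-by-value x) (countB-split-by-value xs) ⟩
    (𝟙 (P x (t ℕ.≤ᵇ g x)) ℕ.+ sum< t (λ e → 𝟙 (P x (g x ℕ.≡ᵇ e))))
      ℕ.+ (countB (λ w → P w (t ℕ.≤ᵇ g w)) xs ℕ.+ sum< t (λ e → countB (λ w → P w (g w ℕ.≡ᵇ e)) xs))
      ≡⟨ +-interchange (𝟙 (P x (t ℕ.≤ᵇ g x))) (sum< t (λ e → 𝟙 (P x (g x ℕ.≡ᵇ e))))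
                       (countB (λ w → P w (t ℕ.≤ᵇ g w)) xs) (sum< t (λ e → countB (λ w → P w (g w ℕ.≡ᵇ e)) xs)) ⟩
    (𝟙 (P x (t ℕ.≤ᵇ g x)) ℕ.+ countB (λ w → P w (t ℕ.≤ᵇ g w)) xs)
      ℕ.+ (sum< t (λ e → 𝟙 (P x (g x ℕ.≡ᵇ e))) ℕ.+ sum< t (λ e → countB (λ w → P w (g w ℕ.≡ᵇ e)) xs))
      ≡⟨ ≡.cong₂ ℕ._+_ (≡.sym (countB-∷ _ x xs))
           (≡.trans (≡.sym (sum<-distrib-+ t _ _)) (sum<-cong t (λ e → ≡.sym (countB-∷ _ x xs)))) ⟩
    countB (λ w → P w (t ℕ.≤ᵇ g w)) (x ∷ xs) ℕ.+ sum< t (λ e → countB (λ w → P w (g w ℕ.≡ᵇ e)) (x ∷ xs)) ∎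
    where open ≡.≡-Reasoning

G-pred : Fin 4 → ℕ → ℕ → List ℕ → Bool → Bool
G-pred s n c w b = isCatalan w ∧ (parity n ℕ.≡ᵇ lenPar s) ∧ (parity (lastCells w) ℕ.≡ᵇ lastPar s) ∧ b ∧ (bck w ℕ.≡ᵇ c)

G-pred-false : ∀ s n c w → G-pred s n c w false ≡ false
G-pred-false s n c w
  rewrite ∧-zeroʳ (parity (lastCells w) ℕ.≡ᵇ lastPar s) | ∧-zeroʳ (parity n ℕ.≡ᵇ lenPar s) = ∧-zeroʳ (isCatalan w)

-- G s n e c reduces to + Gℕ s n e c.
Gℕ : Fin 4 → ℕ → ℕ → ℕ → ℕ
Gℕ s n e c = countB (λ w → G-pred s n c w (⌈ lastCells w /2⌉ ℕ.≡ᵇ e)) (listsOf n n)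

Gℕ≥ : Fin 4 → ℕ → ℕ → ℕ → ℕ
Gℕ≥ s n t c = countB (λ w → G-pred s n c w (t ℕ.≤ᵇ ⌈ lastCells w /2⌉)) (listsOf n n)

G1-⊖-sum<ℤ-G : ∀ s n t c → G1 s n 0 c ℤ.- sum<ℤ t (λ e → G s n e c) ≡ + Gℕ≥ s n t c
G1-⊖-sum<ℤ-G s n t c = begin
  G1 s n 0 c ℤ.- sum<ℤ t (λ e → + Gℕ s n e c)
    ≡⟨ ≡.cong₂ ℤ._-_
         (≡.cong +_ (countB-split-by-value (G-pred s n c) (G-pred-false s n c) (λ w → ⌈ lastCells w /2⌉) t (listsOf n n)))
         (sum<ℤ-+ t (λ e → Gℕ s n e c)) ⟩
  + (Gℕ≥ s n t c ℕ.+ sum< t (λ e → Gℕ s n e c)) ℤ.- + sum< t (λ e → Gℕ s n e c)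
    ≡⟨ solve 2 (λ x y → (x :+ y) :- y := x) refl (+ Gℕ≥ s n t c) (+ sum< t (λ e → Gℕ s n e c)) ⟩
  + Gℕ≥ s n t c ∎
  where
  open ≡.≡-Reasoning
  open ℤ-Solver

M-part : ∀ K α β s n a c →
  (substU K (frac α β) ⊛ Gq (suc K) s) (suc n) a c
    ≡ ℤ.- (if qExp K α β a ℕ.≤ᵇ c then sum<ℤ (suc a ∸ α) (λ e → G s n e (c ∸ qExp K α β a)) else 0ℤ)
M-part K α β s n a c = begin
  (substU K (frac α β) ⊛ Gq (suc K) s) (suc n) a c
    ≡⟨ substU-frac-⊛ K α β (Gq (suc K) s) n a c ⟩
  ℤ.- sumTo a (λ j → if (α ℕ.≤ᵇ j) ∧ (qExp K α β j ℕ.≤ᵇ c) then Gq (suc K) s n (a ∸ j) (c ∸ qExp K α β j) else 0ℤ)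
    ≡⟨ ≡.cong ℤ.-_ (sumTo-cong≤ a summand) ⟩
  ℤ.- sumTo a (λ j → if E ℕ.≤ᵇ c then (if α ℕ.≤ᵇ j then G s n (a ∸ j) (c ∸ E) else 0ℤ) else 0ℤ)
    ≡⟨ ≡.cong ℤ.-_ (sumTo-if (E ℕ.≤ᵇ c) a _) ⟩
  ℤ.- (if E ℕ.≤ᵇ c then sumTo a (λ j → if α ℕ.≤ᵇ j then G s n (a ∸ j) (c ∸ E) else 0ℤ) else 0ℤ)
    ≡⟨ ≡.cong (λ x → ℤ.- (if E ℕ.≤ᵇ c then x else 0ℤ)) (sumTo-from-reverse α a _) ⟩
  ℤ.- (if E ℕ.≤ᵇ c then sum<ℤ (suc a ∸ α) (λ e → G s n e (c ∸ E)) else 0ℤ) ∎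
  where
  open ≡.≡-Reasoning
  E = qExp K α β a
  summand : ∀ j → j ≤ a →
    (if (α ℕ.≤ᵇ j) ∧ (qExp K α β j ℕ.≤ᵇ c) then Gq (suc K) s n (a ∸ j) (c ∸ qExp K α β j) else 0ℤ)
      ≡ (if E ℕ.≤ᵇ c then (if α ℕ.≤ᵇ j then G s n (a ∸ j) (c ∸ E) else 0ℤ) else 0ℤ)
  summand j j≤a with α ℕ.≤ᵇ j in α≤ᵇj
  ... | false = ≡.sym (if-const (E ℕ.≤ᵇ c))
  ... | true  = ≡.trans (if-≤ᵇ-∸ (qExp K α β j) (suc K ℕ.* (a ∸ j)) c (G s n (a ∸ j)))
                  (≡.cong (λ x → if x ℕ.≤ᵇ c then G s n (a ∸ j) (c ∸ x) else 0ℤ) (qExp-shift K α β (≤ᵇ≡true⇒≤ α≤ᵇj) j≤a))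

N-part : ∀ K α β s n a c →
  (substU K (frac α β) ⊛ G1 s) (suc n) a c
    ≡ ℤ.- (if (α ℕ.≤ᵇ a) ∧ (qExp K α β a ℕ.≤ᵇ c) then G1 s n 0 (c ∸ qExp K α β a) else 0ℤ)
N-part K α β s n a c = begin
  (substU K (frac α β) ⊛ G1 s) (suc n) a c
    ≡⟨ substU-frac-⊛ K α β (G1 s) n a c ⟩
  ℤ.- sumTo a (λ j → if (α ℕ.≤ᵇ j) ∧ (qExp K α β j ℕ.≤ᵇ c) then G1 s n (a ∸ j) (c ∸ qExp K α β j) else 0ℤ)
    ≡⟨ ≡.cong ℤ.-_ (sumTo-last a _ below-a) ⟩
  ℤ.- (if (α ℕ.≤ᵇ a) ∧ (qExp K α β a ℕ.≤ᵇ c) then G1 s n (a ∸ a) (c ∸ qExp K α β a) else 0ℤ)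
    ≡⟨ ≡.cong (λ e → ℤ.- (if (α ℕ.≤ᵇ a) ∧ (qExp K α β a ℕ.≤ᵇ c) then G1 s n e (c ∸ qExp K α β a) else 0ℤ)) (ℕₚ.n∸n≡0 a) ⟩
  ℤ.- (if (α ℕ.≤ᵇ a) ∧ (qExp K α β a ℕ.≤ᵇ c) then G1 s n 0 (c ∸ qExp K α β a) else 0ℤ) ∎
  where
  open ≡.≡-Reasoning
  below-a : ∀ j → j < a →
    (if (α ℕ.≤ᵇ j) ∧ (qExp K α β j ℕ.≤ᵇ c) then G1 s n (a ∸ j) (c ∸ qExp K α β j) else 0ℤ) ≡ 0ℤ
  below-a j j<a with a ∸ j in a∸j≡
  ... | zero  = ⊥-elim (ℕₚ.<⇒≱ j<a (ℕₚ.m∸n≡0⇒m≤n a∸j≡))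
  ... | suc _ = if-const ((α ℕ.≤ᵇ j) ∧ (qExp K α β j ℕ.≤ᵇ c))

M-part-aligned : ∀ K α β α′ β′ s n a c → α′ ≤ α → (∀ a → α ≤ a → β ℕ.+ (a ∸ α) ≡ β′ ℕ.+ (a ∸ α′)) →
  (if qExp K α β a ℕ.≤ᵇ c then sum<ℤ (suc a ∸ α) (λ e → G s n e (c ∸ qExp K α β a)) else 0ℤ)
    ≡ (if (α′ ℕ.≤ᵇ a) ∧ (qExp K α′ β′ a ℕ.≤ᵇ c) then sum<ℤ (suc a ∸ α) (λ e → G s n e (c ∸ qExp K α′ β′ a)) else 0ℤ)
M-part-aligned K α β α′ β′ s n a c α′≤α same-qExp with α ℕₚ.≤? a
... | yes α≤a rewrite same-qExp a α≤a | ≤⇒≤ᵇ≡true (ℕₚ.≤-trans α′≤α α≤a) = refl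
... | no  α≰a rewrite ℕₚ.m≤n⇒m∸n≡0 (ℕₚ.≰⇒> α≰a) =
  ≡.trans (if-const (qExp K α β a ℕ.≤ᵇ c)) (≡.sym (if-const ((α′ ℕ.≤ᵇ a) ∧ (qExp K α′ β′ a ℕ.≤ᵇ c))))

M-part⊖N-part : ∀ K α β α′ β′ s n a c → α′ ≤ α → (∀ a → α ≤ a → β ℕ.+ (a ∸ α) ≡ β′ ℕ.+ (a ∸ α′)) →
  (substU K (frac α β) ⊛ Gq (suc K) s) (suc n) a c ℤ.- (substU K (frac α′ β′) ⊛ G1 s) (suc n) a c
    ≡ + (if (α′ ℕ.≤ᵇ a) ∧ (qExp K α′ β′ a ℕ.≤ᵇ c) then Gℕ≥ s n (suc a ∸ α) (c ∸ qExp K α′ β′ a) else 0)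
M-part⊖N-part K α β α′ β′ s n a c α′≤α same-qExp
  rewrite M-part K α β s n a c | N-part K α′ β′ s n a c | M-part-aligned K α β α′ β′ s n a c α′≤α same-qExp
  with (α′ ℕ.≤ᵇ a) ∧ (qExp K α′ β′ a ℕ.≤ᵇ c)
... | false = refl
... | true  = ≡.trans (solve 2 (λ x y → (:- x) :- (:- y) := y :- x) refl X (G1 s n 0 (c ∸ E′)))
                      (G1-⊖-sum<ℤ-G s n (suc a ∸ α) (c ∸ E′))
  where
  open ℤ-Solver
  E′ = qExp K α′ β′ a
  X = sum<ℤ (suc a ∸ α) (λ e → G s n e (c ∸ E′))

-- Removing the last column

lastOf : ℕ → List ℕ → ℕ
lastOf p []       = p
lastOf p (y ∷ ys) = lastOf y ys

lastCells-∷ : ∀ x xs → lastCells (x ∷ xs) ≡ suc (lastOf x xs)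
lastCells-∷ x []       = refl
lastCells-∷ x (y ∷ ys) = lastCells-∷ y ys

lastCells-∷ʳ : ∀ w v → lastCells (w ∷ʳ v) ≡ suc v
lastCells-∷ʳ []           v = refl
lastCells-∷ʳ (x ∷ [])     v = refl
lastCells-∷ʳ (x ∷ y ∷ ys) v = lastCells-∷ʳ (y ∷ ys) v

catTail-∷ʳ : ∀ p xs v → catTail p (xs ∷ʳ v) ≡ catTail p xs ∧ (v ℕ.≤ᵇ suc (lastOf p xs))
catTail-∷ʳ p []       v = ∧-identityʳ _
catTail-∷ʳ p (y ∷ ys) v rewrite catTail-∷ʳ y ys v = ≡.sym (∧-assoc (y ℕ.≤ᵇ suc p) (catTail y ys) _)

isCatalan-∷ʳ : ∀ x xs v → isCatalan ((x ∷ xs) ∷ʳ v) ≡ isCatalan (x ∷ xs) ∧ (v ℕ.≤ᵇ lastCells (x ∷ xs))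
isCatalan-∷ʳ x xs v rewrite catTail-∷ʳ x xs v | lastCells-∷ x xs = ≡.sym (∧-assoc (x ℕ.≡ᵇ 0) (catTail x xs) _)

-- flips n e is the colour flag of the column n places to the right of one with flag e.
flips : ℕ → Bool → Bool
flips zero    e = e
flips (suc k) e = flips k (not e)

flips-parity : ∀ n e → flips n e ≡ (if parity n ℕ.≡ᵇ 0 then e else not e)
flips-parity zero          e = refl
flips-parity (suc zero)    e = refl
flips-parity (suc (suc n)) e rewrite flips-parity n (not (not e)) | not-involutive e = refl

bckFrom-∷ʳ : ∀ e w v → bckFrom e (w ∷ʳ v) ≡ bckFrom e w ℕ.+ blackInCol (flips (length w) e) v
bckFrom-∷ʳ true  []       v = ℕₚ.+-identityʳ _
bckFrom-∷ʳ false []       v = ℕₚ.+-identityʳ _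
bckFrom-∷ʳ true  (x ∷ xs) v rewrite bckFrom-∷ʳ false xs v = ≡.sym (ℕₚ.+-assoc (blackInCol true x) (bckFrom false xs) _)
bckFrom-∷ʳ false (x ∷ xs) v rewrite bckFrom-∷ʳ true xs v = ≡.sym (ℕₚ.+-assoc (blackInCol false x) (bckFrom true xs) _)

lastOf-≤ : ∀ p xs → catTail p xs ≡ true → lastOf p xs ≤ p ℕ.+ length xs
lastOf-≤ p []       _  = ℕₚ.m≤m+n p 0
lastOf-≤ p (y ∷ ys) ok with y ℕ.≤ᵇ suc p in y≤ᵇ1+p | catTail y ys in ok′
... | true | true = begin
  lastOf y ys             ≤⟨ lastOf-≤ y ys ok′ ⟩
  y ℕ.+ length ys         ≤⟨ ℕₚ.+-monoˡ-≤ (length ys) (≤ᵇ≡true⇒≤ y≤ᵇ1+p) ⟩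
  suc p ℕ.+ length ys     ≡⟨ ℕₚ.+-suc p (length ys) ⟨
  p ℕ.+ suc (length ys)   ∎
  where open ℕₚ.≤-Reasoning

lastCells-≤-length : ∀ x xs → isCatalan (x ∷ xs) ≡ true → lastCells (x ∷ xs) ≤ suc (length xs)
lastCells-≤-length zero xs ok rewrite lastCells-∷ zero xs = s≤s (lastOf-≤ zero xs ok)

sumWords : ℕ → ℕ → (List ℕ → ℕ) → ℕ
sumWords zero    b f = f []
sumWords (suc n) b f = sum< b (λ v → sumWords n b (λ w → f (v ∷ w)))

sum-map-applyUpTo : ∀ b h (g : ℕ → ℕ) → sum (map g (applyUpTo h b)) ≡ sum< b (λ v → g (h v))
sum-map-applyUpTo zero    h g = refl
sum-map-applyUpTo (suc b) h g rewrite sum-map-applyUpTo b (λ v → h (suc v)) g = ≡.sym (sum<-suc-head b (λ v → g (h v)))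

countB-++ : ∀ {A : Set} (p : A → Bool) xs ys → countB p (xs ++ ys) ≡ countB p xs ℕ.+ countB p ys
countB-++ p []       ys = refl
countB-++ p (x ∷ xs) ys with p x
... | true  = ≡.cong suc (countB-++ p xs ys)
... | false = countB-++ p xs ys

countB-concatMap : ∀ {A B : Set} (p : B → Bool) (f : A → List B) xs →
                   countB p (concatMap f xs) ≡ sum (map (λ x → countB p (f x)) xs)
countB-concatMap p f []       = refl
countB-concatMap p f (x ∷ xs) =
  ≡.trans (countB-++ p (f x) (concat (map f xs))) (≡.cong (countB p (f x) ℕ.+_) (countB-concatMap p f xs))

countB-map : ∀ {A B : Set} (p : B → Bool) (g : A → B) xs → countB p (map g xs) ≡ countB (λ x → p (g x)) xs
countB-map p g []       = refl
countB-map p g (x ∷ xs) with p (g x)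
... | true  = ≡.cong suc (countB-map p g xs)
... | false = countB-map p g xs

countB-listsOf : ∀ n b p → countB p (listsOf n b) ≡ sumWords n b (λ w → 𝟙 (p w))
countB-listsOf zero    b p with p []
... | true  = refl
... | false = refl
countB-listsOf (suc n) b p =
  ≡.trans (countB-concatMap p _ (upTo b)) (≡.trans (sum-map-applyUpTo b (λ v → v) _)
    (sum<-cong b (λ v → ≡.trans (countB-map p (v ∷_) (listsOf n b)) (countB-listsOf n b (λ w → p (v ∷ w))))))

sumWords-cong : ∀ n b {f g} → (∀ w → length w ≡ n → f w ≡ g w) → sumWords n b f ≡ sumWords n b g
sumWords-cong zero    b f≡g = f≡g [] refl
sumWords-cong (suc n) b f≡g = sum<-cong b (λ v → sumWords-cong n b (λ w ∣w∣≡n → f≡g (v ∷ w) (≡.cong suc ∣w∣≡n)))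

sumWords-zero : ∀ n b f → (∀ w → f w ≡ 0) → sumWords n b f ≡ 0
sumWords-zero zero    b f f≡0 = f≡0 []
sumWords-zero (suc n) b f f≡0 = sum<-zero b _ (λ v → sumWords-zero n b _ (λ w → f≡0 (v ∷ w)))

sumWords-distrib-+ : ∀ n b f g → sumWords n b (λ w → f w ℕ.+ g w) ≡ sumWords n b f ℕ.+ sumWords n b g
sumWords-distrib-+ zero    b f g = refl
sumWords-distrib-+ (suc n) b f g = ≡.trans (sum<-cong b (λ v → sumWords-distrib-+ n b _ _)) (sum<-distrib-+ b _ _)

sumWords-if : ∀ n b c f → sumWords n b (λ w → if c then f w else 0) ≡ (if c then sumWords n b f else 0)
sumWords-if n b true  f = refl
sumWords-if n b false f = sumWords-zero n b _ (λ _ → refl)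

sumWords-∷ʳ : ∀ n b f → sumWords (suc n) b f ≡ sumWords n b (λ w → sum< b (λ v → f (w ∷ʳ v)))
sumWords-∷ʳ zero    b f = refl
sumWords-∷ʳ (suc n) b f = sum<-cong b (λ v → sumWords-∷ʳ n b (λ w → f (v ∷ w)))

data ParityView : ℕ → Set where
  even : ∀ k → ParityView (k ℕ.+ k)
  odd  : ∀ k → ParityView (suc (k ℕ.+ k))

parityView : ∀ v → ParityView v
parityView zero = even 0
parityView (suc v) with parityView v
... | even k = odd k
... | odd  k = ≡.subst ParityView (≡.cong suc (ℕₚ.+-suc k k)) (even (suc k))

parity-even : ∀ k → parity (k ℕ.+ k) ≡ 0
parity-even zero    = refl
parity-even (suc k) rewrite ℕₚ.+-suc k k = parity-even k

parity-odd : ∀ k → parity (suc (k ℕ.+ k)) ≡ 1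
parity-odd zero    = refl
parity-odd (suc k) rewrite ℕₚ.+-suc k k = parity-odd k

⌈k+k/2⌉≡k : ∀ k → ⌈ k ℕ.+ k /2⌉ ≡ k
⌈k+k/2⌉≡k k = ≡.sym (ℕₚ.n≡⌈n+n/2⌉ k)

⌊k+k/2⌋≡k : ∀ k → ⌊ k ℕ.+ k /2⌋ ≡ k
⌊k+k/2⌋≡k k = ≡.sym (ℕₚ.n≡⌊n+n/2⌋ k)

k+k-injective : ∀ {k a} → k ℕ.+ k ≡ a ℕ.+ a → k ≡ a
k+k-injective {k} {a} eq = ≡.trans (≡.sym (⌈k+k/2⌉≡k k)) (≡.trans (≡.cong ⌈_/2⌉ eq) (⌈k+k/2⌉≡k a))

even≢odd : ∀ k a → k ℕ.+ k ≢ suc (a ℕ.+ a)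
even≢odd k a eq with ≡.trans (≡.sym (parity-even k)) (≡.trans (≡.cong parity eq) (parity-odd a))
... | ()

letter-of-even-column : ∀ v a → ((parity (suc v) ℕ.≡ᵇ 0) ∧ (⌈ suc v /2⌉ ℕ.≡ᵇ suc a)) ≡ (v ℕ.≡ᵇ suc (a ℕ.+ a))
letter-of-even-column v a with parityView v
... | even k rewrite parity-odd k = ≡.sym (≢⇒≡ᵇ≡false (even≢odd k a))
... | odd  k rewrite parity-even k | ⌈k+k/2⌉≡k k =
  ≡ᵇ-cong-⇔ {k} {a} {k ℕ.+ k} {a ℕ.+ a} (λ k≡a → ≡.cong₂ ℕ._+_ k≡a k≡a) k+k-injective

letter-of-odd-column : ∀ v a → ((parity (suc v) ℕ.≡ᵇ 1) ∧ (⌈ suc v /2⌉ ℕ.≡ᵇ suc a)) ≡ (v ℕ.≡ᵇ a ℕ.+ a)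
letter-of-odd-column v a with parityView v
... | even k rewrite parity-odd k | ⌊k+k/2⌋≡k k =
  ≡ᵇ-cong-⇔ {k} {a} {k ℕ.+ k} {a ℕ.+ a} (λ k≡a → ≡.cong₂ ℕ._+_ k≡a k≡a) k+k-injective
... | odd  k rewrite parity-even k = ≡.sym (≢⇒≡ᵇ≡false (λ eq → even≢odd a k (≡.sym eq)))

even≤ᵇeven : ∀ a k → (a ℕ.+ a ℕ.≤ᵇ k ℕ.+ k) ≡ (a ℕ.≤ᵇ k)
even≤ᵇeven a k = ≤ᵇ-cong-⇔
  (λ 2a≤2k → ≡.subst₂ _≤_ (⌊k+k/2⌋≡k a) (⌊k+k/2⌋≡k k) (ℕₚ.⌊n/2⌋-mono 2a≤2k))
  (λ a≤k → ℕₚ.+-mono-≤ a≤k a≤k)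

odd≤ᵇodd : ∀ a k → (suc (a ℕ.+ a) ℕ.≤ᵇ suc (k ℕ.+ k)) ≡ (suc a ℕ.≤ᵇ suc k)
odd≤ᵇodd a k = ≡.trans (suc-≤ᵇ-suc (a ℕ.+ a) (k ℕ.+ k)) (≡.trans (even≤ᵇeven a k) (≡.sym (suc-≤ᵇ-suc a k)))

odd≤ᵇeven : ∀ a k → (suc (a ℕ.+ a) ℕ.≤ᵇ k ℕ.+ k) ≡ (suc a ℕ.≤ᵇ k)
odd≤ᵇeven a k = ≤ᵇ-cong-⇔
  (λ 2a+1≤2k → ≡.subst₂ _≤_ (≡.cong suc (⌊k+k/2⌋≡k a)) (⌈k+k/2⌉≡k k) (ℕₚ.⌈n/2⌉-mono 2a+1≤2k))
  (λ a<k → ℕₚ.≤-trans (ℕₚ.≤-trans (ℕₚ.n≤1+n _) (ℕₚ.≤-reflexive (≡.cong suc (≡.sym (ℕₚ.+-suc a a))))) (ℕₚ.+-mono-≤ a<k a<k))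

even≤ᵇodd : ∀ a k → (a ℕ.+ a ℕ.≤ᵇ suc (k ℕ.+ k)) ≡ (suc a ℕ.≤ᵇ suc k)
even≤ᵇodd a k = ≤ᵇ-cong-⇔
  (λ 2a≤2k+1 → s≤s (≡.subst₂ _≤_ (⌊k+k/2⌋≡k a) (⌈k+k/2⌉≡k k) (ℕₚ.⌊n/2⌋-mono 2a≤2k+1)))
  (λ a<1+k → ℕₚ.m≤n⇒m≤1+n (ℕₚ.+-mono-≤ (ℕₚ.≤-pred a<1+k) (ℕₚ.≤-pred a<1+k)))

appended-letter-count : ∀ (P : Bool) e N L b c v₀ D lp a →
  (P ≡ true → blackInCol e v₀ ≡ D) →
  (∀ v → ((parity (suc v) ℕ.≡ᵇ lp) ∧ (⌈ suc v /2⌉ ℕ.≡ᵇ suc a)) ≡ (v ℕ.≡ᵇ v₀)) →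
  L < N →
  sum< N (λ v → 𝟙 ((v ℕ.≤ᵇ L) ∧ P ∧ (parity (suc v) ℕ.≡ᵇ lp) ∧ (⌈ suc v /2⌉ ℕ.≡ᵇ suc a) ∧ (b ℕ.+ blackInCol e v ℕ.≡ᵇ c)))
    ≡ 𝟙 (P ∧ (v₀ ℕ.≤ᵇ L) ∧ (b ℕ.+ D ℕ.≡ᵇ c))
appended-letter-count false e N L b c v₀ D lp a _ _ _ = sum<-zero N _ (λ v → ≡.cong 𝟙 (∧-zeroʳ (v ℕ.≤ᵇ L)))
appended-letter-count true e N L b c v₀ D lp a black last-letter L<N = begin
  sum< N (λ v → 𝟙 ((v ℕ.≤ᵇ L) ∧ (parity (suc v) ℕ.≡ᵇ lp) ∧ (⌈ suc v /2⌉ ℕ.≡ᵇ suc a) ∧ (b ℕ.+ blackInCol e v ℕ.≡ᵇ c)))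
    ≡⟨ sum<-cong N (λ v → ≡.cong 𝟙 (reorder (v ℕ.≤ᵇ L) (parity (suc v) ℕ.≡ᵇ lp) (⌈ suc v /2⌉ ℕ.≡ᵇ suc a)
                                             (b ℕ.+ blackInCol e v ℕ.≡ᵇ c))) ⟩
  sum< N (λ v → 𝟙 (((parity (suc v) ℕ.≡ᵇ lp) ∧ (⌈ suc v /2⌉ ℕ.≡ᵇ suc a)) ∧ Q v))
    ≡⟨ sum<-cong N (λ v → ≡.cong (λ x → 𝟙 (x ∧ Q v)) (last-letter v)) ⟩
  sum< N (λ v → 𝟙 ((v ℕ.≡ᵇ v₀) ∧ Q v))
    ≡⟨ sum<-𝟙-single N v₀ Q v₀<N ⟩
  𝟙 ((v₀ ℕ.≤ᵇ L) ∧ (b ℕ.+ blackInCol e v₀ ℕ.≡ᵇ c))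
    ≡⟨ ≡.cong (λ d → 𝟙 ((v₀ ℕ.≤ᵇ L) ∧ (b ℕ.+ d ℕ.≡ᵇ c))) (black refl) ⟩
  𝟙 ((v₀ ℕ.≤ᵇ L) ∧ (b ℕ.+ D ℕ.≡ᵇ c)) ∎
  where
  open ≡.≡-Reasoning
  Q : ℕ → Bool
  Q v = (v ℕ.≤ᵇ L) ∧ (b ℕ.+ blackInCol e v ℕ.≡ᵇ c)
  reorder : ∀ x y z r → x ∧ y ∧ z ∧ r ≡ (y ∧ z) ∧ x ∧ r
  reorder true  true  z     r = refl
  reorder true  false z     r = refl
  reorder false true  true  r = refl
  reorder false true  false r = refl
  reorder false false z     r = refl
  v₀<N : Q v₀ ≡ true → v₀ < N
  v₀<N Qv₀ with v₀ ℕ.≤ᵇ L in v₀≤ᵇL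
  ... | true = ℕₚ.≤-<-trans (≤ᵇ≡true⇒≤ v₀≤ᵇL) L<N

𝟙-by-parity : ∀ L v₀ t₀ t₁ x → (∀ k → (v₀ ℕ.≤ᵇ k ℕ.+ k) ≡ (t₀ ℕ.≤ᵇ k)) → (∀ k → (v₀ ℕ.≤ᵇ suc (k ℕ.+ k)) ≡ (t₁ ℕ.≤ᵇ suc k)) →
  𝟙 ((v₀ ℕ.≤ᵇ L) ∧ x)
    ≡ 𝟙 ((parity L ℕ.≡ᵇ 0) ∧ (t₀ ℕ.≤ᵇ ⌈ L /2⌉) ∧ x) ℕ.+ 𝟙 ((parity L ℕ.≡ᵇ 1) ∧ (t₁ ℕ.≤ᵇ ⌈ L /2⌉) ∧ x)
𝟙-by-parity L v₀ t₀ t₁ x fits-even fits-odd with parityView L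
... | even k rewrite parity-even k | ⌈k+k/2⌉≡k k | fits-even k = ≡.sym (ℕₚ.+-identityʳ _)
... | odd  k rewrite parity-odd k | fits-odd k = ≡.cong (λ h → 𝟙 ((t₁ ℕ.≤ᵇ suc h) ∧ x)) (≡.sym (⌊k+k/2⌋≡k k))

sumWords-catTail-alphabet : ∀ m p b (F : List ℕ → ℕ) → p ℕ.+ m < b →
  sumWords m b (λ ws → if catTail p ws then F ws else 0) ≡ sumWords m (suc b) (λ ws → if catTail p ws then F ws else 0)
sumWords-catTail-alphabet zero    p b F _     = refl
sumWords-catTail-alphabet (suc m) p b F p+m<b =
  ≡.trans (sum<-cong b first-letter) (≡.sym (≡.trans (≡.cong (below-b ℕ.+_) letter-b) (ℕₚ.+-identityʳ below-b)))
  where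
  below-b = sum< b (λ v → sumWords m (suc b) (λ ws → if (v ℕ.≤ᵇ suc p) ∧ catTail v ws then F (v ∷ ws) else 0))
  first-letter : ∀ v →
    sumWords m b (λ ws → if (v ℕ.≤ᵇ suc p) ∧ catTail v ws then F (v ∷ ws) else 0)
      ≡ sumWords m (suc b) (λ ws → if (v ℕ.≤ᵇ suc p) ∧ catTail v ws then F (v ∷ ws) else 0)
  first-letter v with v ℕ.≤ᵇ suc p in v≤ᵇ1+p
  ... | true  = sumWords-catTail-alphabet m v b (λ ws → F (v ∷ ws))
                  (ℕₚ.≤-<-trans (ℕₚ.+-monoˡ-≤ m (≤ᵇ≡true⇒≤ v≤ᵇ1+p)) (≡.subst (ℕ._< b) (ℕₚ.+-suc p m) p+m<b))
  ... | false = ≡.trans (sumWords-zero m b _ (λ _ → refl)) (≡.sym (sumWords-zero m (suc b) _ (λ _ → refl)))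
  letter-b : sumWords m (suc b) (λ ws → if (b ℕ.≤ᵇ suc p) ∧ catTail b ws then F (b ∷ ws) else 0) ≡ 0
  letter-b rewrite >⇒≤ᵇ≡false {b} {suc p} (ℕₚ.≤-<-trans (s≤s (ℕₚ.m≤m+n p m)) (≡.subst (ℕ._< b) (ℕₚ.+-suc p m) p+m<b)) =
    sumWords-zero m (suc b) _ (λ _ → refl)

sumWords-isCatalan-alphabet : ∀ n b (F : List ℕ → ℕ) → suc n ≤ b →
  sumWords (suc n) b (λ w → if isCatalan w then F w else 0) ≡ sumWords (suc n) (suc b) (λ w → if isCatalan w then F w else 0)
sumWords-isCatalan-alphabet n b F n<b =
  ≡.trans (sum<-cong b first-letter) (≡.sym (≡.trans (≡.cong (below-b ℕ.+_) letter-b) (ℕₚ.+-identityʳ below-b)))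
  where
  below-b = sum< b (λ v → sumWords n (suc b) (λ ws → if (v ℕ.≡ᵇ 0) ∧ catTail v ws then F (v ∷ ws) else 0))
  first-letter : ∀ v →
    sumWords n b (λ ws → if (v ℕ.≡ᵇ 0) ∧ catTail v ws then F (v ∷ ws) else 0)
      ≡ sumWords n (suc b) (λ ws → if (v ℕ.≡ᵇ 0) ∧ catTail v ws then F (v ∷ ws) else 0)
  first-letter zero    = sumWords-catTail-alphabet n 0 b (λ ws → F (0 ∷ ws)) n<b
  first-letter (suc v) = ≡.trans (sumWords-zero n b _ (λ _ → refl)) (≡.sym (sumWords-zero n (suc b) _ (λ _ → refl)))
  letter-b : sumWords n (suc b) (λ ws → if (b ℕ.≡ᵇ 0) ∧ catTail b ws then F (b ∷ ws) else 0) ≡ 0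
  letter-b rewrite ≢⇒≡ᵇ≡false {b} {0} (ℕₚ.>⇒≢ (ℕₚ.<-≤-trans (s≤s z≤n) n<b)) = sumWords-zero n (suc b) _ (λ _ → refl)

-- A word of length m + 2 in the class (lenPar⁺, lastPar⁺) with ⌈last/2⌉ = a + 1 ends in
-- the letter v₀. Removing it leaves a word of length m + 1 in the class (lenPar⁻, ·)
-- whose last column must have at least v₀ cells; depending on the parity of that column
-- this reads t₀ ≤ ⌈last/2⌉ or t₁ ≤ ⌈last/2⌉. The removed column had D black cells.
module LastColumnRemoval
  (lenPar⁺ lenPar⁻ lastPar⁺ a D t₀ t₁ v₀ : ℕ)
  (length-flip : ∀ n → (parity (suc n) ℕ.≡ᵇ lenPar⁺) ≡ (parity n ℕ.≡ᵇ lenPar⁻))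
  (black-last : ∀ n → (parity (suc n) ℕ.≡ᵇ lenPar⁺) ≡ true → blackInCol (flips n true) v₀ ≡ D)
  (last-letter : ∀ v → ((parity (suc v) ℕ.≡ᵇ lastPar⁺) ∧ (⌈ suc v /2⌉ ℕ.≡ᵇ suc a)) ≡ (v ℕ.≡ᵇ v₀))
  (fits-even : ∀ k → (v₀ ℕ.≤ᵇ k ℕ.+ k) ≡ (t₀ ℕ.≤ᵇ k))
  (fits-odd : ∀ k → (v₀ ℕ.≤ᵇ suc (k ℕ.+ k)) ≡ (t₁ ℕ.≤ᵇ suc k))
  (m c : ℕ)
  where

  n : ℕ
  n = suc m

  longer : List ℕ → Bool
  longer w = isCatalan w ∧ (parity (suc n) ℕ.≡ᵇ lenPar⁺) ∧ (parity (lastCells w) ℕ.≡ᵇ lastPar⁺)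
           ∧ (⌈ lastCells w /2⌉ ℕ.≡ᵇ suc a) ∧ (bck w ℕ.≡ᵇ c)

  shorter : ℕ → ℕ → List ℕ → Bool
  shorter lastPar t w = isCatalan w ∧ (parity n ℕ.≡ᵇ lenPar⁻) ∧ (parity (lastCells w) ℕ.≡ᵇ lastPar)
                      ∧ (t ℕ.≤ᵇ ⌈ lastCells w /2⌉) ∧ (bck w ℕ.≡ᵇ c ∸ D)

  extensions : List ℕ → ℕ
  extensions w = if D ℕ.≤ᵇ c then 𝟙 (shorter 0 t₀ w) ℕ.+ 𝟙 (shorter 1 t₁ w) else 0

  extensions-Catalan : ∀ w → isCatalan w ≡ true →
    𝟙 ((parity (suc n) ℕ.≡ᵇ lenPar⁺) ∧ (v₀ ℕ.≤ᵇ lastCells w) ∧ (bck w ℕ.+ D ℕ.≡ᵇ c)) ≡ extensions w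
  extensions-Catalan w Catalan rewrite Catalan | length-flip n | +-≡ᵇ (bck w) D c
    with parity n ℕ.≡ᵇ lenPar⁻ | D ℕ.≤ᵇ c
  ... | false | true  = refl
  ... | false | false = refl
  ... | true  | false = ≡.cong 𝟙 (∧-zeroʳ (v₀ ℕ.≤ᵇ lastCells w))
  ... | true  | true  = 𝟙-by-parity (lastCells w) v₀ t₀ t₁ (bck w ℕ.≡ᵇ c ∸ D) fits-even fits-odd

  extensions-count : ∀ w → length w ≡ n →
    sum< (suc n) (λ v → 𝟙 (longer (w ∷ʳ v))) ≡ (if isCatalan w then extensions w else 0)
  extensions-count (x ∷ xs) ∣w∣≡n =
    ≡.trans (sum<-cong (suc n) (λ v → ≡.cong 𝟙 (longer-∷ʳ v))) (by-Catalan (isCatalan w) refl)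
    where
    w = x ∷ xs
    L = lastCells w
    length-ok = parity (suc n) ℕ.≡ᵇ lenPar⁺
    new-column = flips n true
    longer-∷ʳ : ∀ v → longer (w ∷ʳ v)
      ≡ (isCatalan w ∧ (v ℕ.≤ᵇ L)) ∧ length-ok ∧ (parity (suc v) ℕ.≡ᵇ lastPar⁺) ∧ (⌈ suc v /2⌉ ℕ.≡ᵇ suc a)
          ∧ (bck w ℕ.+ blackInCol new-column v ℕ.≡ᵇ c)
    longer-∷ʳ v rewrite isCatalan-∷ʳ x xs v | lastCells-∷ʳ w v | bckFrom-∷ʳ true w v | ℕₚ.suc-injective ∣w∣≡n = refl
    by-Catalan : ∀ b → isCatalan w ≡ b →
      sum< (suc n) (λ v → 𝟙 ((b ∧ (v ℕ.≤ᵇ L)) ∧ length-ok ∧ (parity (suc v) ℕ.≡ᵇ lastPar⁺) ∧ (⌈ suc v /2⌉ ℕ.≡ᵇ suc a)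
                                ∧ (bck w ℕ.+ blackInCol new-column v ℕ.≡ᵇ c)))
        ≡ (if b then extensions w else 0)
    by-Catalan false _       = sum<-zero (suc n) _ (λ v → refl)
    by-Catalan true  Catalan =
      ≡.trans (appended-letter-count length-ok new-column (suc n) L (bck w) c v₀ D lastPar⁺ a (black-last n) last-letter
                 (s≤s (ℕₚ.≤-trans (lastCells-≤-length x xs Catalan) (ℕₚ.≤-reflexive ∣w∣≡n))))
              (extensions-Catalan w Catalan)

  count : countB longer (listsOf (suc n) (suc n))
        ≡ (if D ℕ.≤ᵇ c then countB (shorter 0 t₀) (listsOf n n) ℕ.+ countB (shorter 1 t₁) (listsOf n n) else 0)
  count = begin
    countB longer (listsOf (suc n) (suc n))
      ≡⟨ countB-listsOf (suc n) (suc n) longer ⟩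
    sumWords (suc n) (suc n) (λ w → 𝟙 (longer w))
      ≡⟨ sumWords-∷ʳ n (suc n) (λ w → 𝟙 (longer w)) ⟩
    sumWords n (suc n) (λ w → sum< (suc n) (λ v → 𝟙 (longer (w ∷ʳ v))))
      ≡⟨ sumWords-cong n (suc n) extensions-count ⟩
    sumWords n (suc n) (λ w → if isCatalan w then extensions w else 0)
      ≡⟨ sumWords-isCatalan-alphabet m n extensions ℕₚ.≤-refl ⟨
    sumWords n n (λ w → if isCatalan w then extensions w else 0)
      ≡⟨ sumWords-cong n n (λ w _ → only-Catalan w) ⟩
    sumWords n n extensions
      ≡⟨ sumWords-if n n (D ℕ.≤ᵇ c) (λ w → 𝟙 (shorter 0 t₀ w) ℕ.+ 𝟙 (shorter 1 t₁ w)) ⟩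
    (if D ℕ.≤ᵇ c then sumWords n n (λ w → 𝟙 (shorter 0 t₀ w) ℕ.+ 𝟙 (shorter 1 t₁ w)) else 0)
      ≡⟨ ≡.cong (λ x → if D ℕ.≤ᵇ c then x else 0)
           (≡.trans (sumWords-distrib-+ n n (λ w → 𝟙 (shorter 0 t₀ w)) (λ w → 𝟙 (shorter 1 t₁ w)))
             (≡.sym (≡.cong₂ ℕ._+_ (countB-listsOf n n (shorter 0 t₀)) (countB-listsOf n n (shorter 1 t₁))))) ⟩
    (if D ℕ.≤ᵇ c then countB (shorter 0 t₀) (listsOf n n) ℕ.+ countB (shorter 1 t₁) (listsOf n n) else 0) ∎
    where
    open ≡.≡-Reasoning
    only-Catalan : ∀ w → (if isCatalan w then extensions w else 0) ≡ extensions w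
    only-Catalan w with isCatalan w | D ℕ.≤ᵇ c
    ... | true  | _     = refl
    ... | false | true  = refl
    ... | false | false = refl

parity-suc≡ᵇ0 : ∀ n → (parity (suc n) ℕ.≡ᵇ 0) ≡ (parity n ℕ.≡ᵇ 1)
parity-suc≡ᵇ0 n with parityView n
... | even k rewrite parity-odd k | parity-even k = refl
... | odd  k rewrite parity-odd k | parity-even k = refl

parity-suc≡ᵇ1 : ∀ n → (parity (suc n) ℕ.≡ᵇ 1) ≡ (parity n ℕ.≡ᵇ 0)
parity-suc≡ᵇ1 n with parityView n
... | even k rewrite parity-odd k | parity-even k = refl
... | odd  k rewrite parity-odd k | parity-even k = refl

flips-odd : ∀ n → (parity (suc n) ℕ.≡ᵇ 0) ≡ true → flips n true ≡ false
flips-odd n even-length rewrite flips-parity n true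
  | ≡ᵇ≡true⇒≡ {parity n} {1} (≡.trans (≡.sym (parity-suc≡ᵇ0 n)) even-length) = refl

flips-even : ∀ n → (parity (suc n) ℕ.≡ᵇ 1) ≡ true → flips n true ≡ true
flips-even n odd-length rewrite flips-parity n true
  | ≡ᵇ≡true⇒≡ {parity n} {0} (≡.trans (≡.sym (parity-suc≡ᵇ1 n)) odd-length) = refl

Gℕ-last-column₀ : ∀ m a c → Gℕ i0 (suc (suc m)) (suc a) c
  ≡ (if suc a ℕ.≤ᵇ c then Gℕ≥ i2 (suc m) (suc a) (c ∸ suc a) ℕ.+ Gℕ≥ i3 (suc m) (suc a) (c ∸ suc a) else 0)
Gℕ-last-column₀ m a c = LastColumnRemoval.count 0 1 0 a (suc a) (suc a) (suc a) (suc (a ℕ.+ a)) parity-suc≡ᵇ0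
  (λ n even-length → ≡.trans (≡.cong (λ e → blackInCol e (suc (a ℕ.+ a))) (flips-odd n even-length))
                             (≡.cong suc (⌊k+k/2⌋≡k a)))
  (λ v → letter-of-even-column v a) (odd≤ᵇeven a) (odd≤ᵇodd a) m c

Gℕ-last-column₁ : ∀ m a c → Gℕ i1 (suc (suc m)) (suc a) c
  ≡ (if a ℕ.≤ᵇ c then Gℕ≥ i2 (suc m) a (c ∸ a) ℕ.+ Gℕ≥ i3 (suc m) (suc a) (c ∸ a) else 0)
Gℕ-last-column₁ m a c = LastColumnRemoval.count 0 1 1 a a a (suc a) (a ℕ.+ a) parity-suc≡ᵇ0
  (λ n even-length → ≡.trans (≡.cong (λ e → blackInCol e (a ℕ.+ a)) (flips-odd n even-length)) (⌈k+k/2⌉≡k a))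
  (λ v → letter-of-odd-column v a) (even≤ᵇeven a) (even≤ᵇodd a) m c

Gℕ-last-column₂ : ∀ m a c → Gℕ i2 (suc (suc m)) (suc a) c
  ≡ (if suc a ℕ.≤ᵇ c then Gℕ≥ i0 (suc m) (suc a) (c ∸ suc a) ℕ.+ Gℕ≥ i1 (suc m) (suc a) (c ∸ suc a) else 0)
Gℕ-last-column₂ m a c = LastColumnRemoval.count 1 0 0 a (suc a) (suc a) (suc a) (suc (a ℕ.+ a)) parity-suc≡ᵇ1
  (λ n odd-length → ≡.trans (≡.cong (λ e → blackInCol e (suc (a ℕ.+ a))) (flips-even n odd-length))
                            (≡.cong suc (⌈k+k/2⌉≡k a)))
  (λ v → letter-of-even-column v a) (odd≤ᵇeven a) (odd≤ᵇodd a) m c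

Gℕ-last-column₃ : ∀ m a c → Gℕ i3 (suc (suc m)) (suc a) c
  ≡ (if suc a ℕ.≤ᵇ c then Gℕ≥ i0 (suc m) a (c ∸ suc a) ℕ.+ Gℕ≥ i1 (suc m) (suc a) (c ∸ suc a) else 0)
Gℕ-last-column₃ m a c = LastColumnRemoval.count 1 0 1 a (suc a) a (suc a) (a ℕ.+ a) parity-suc≡ᵇ1
  (λ n odd-length → ≡.trans (≡.cong (λ e → blackInCol e (a ℕ.+ a)) (flips-even n odd-length)) (≡.cong suc (⌊k+k/2⌋≡k a)))
  (λ v → letter-of-odd-column v a) (even≤ᵇeven a) (even≤ᵇodd a) m c

-- The functional equation

countB-zero : ∀ {A : Set} (p : A → Bool) xs → (∀ x → p x ≡ false) → countB p xs ≡ 0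
countB-zero p []       p≡false = refl
countB-zero p (x ∷ xs) p≡false rewrite p≡false x = countB-zero p xs p≡false

Gℕ-zero : ∀ i n c → Gℕ i n 0 c ≡ 0
Gℕ-zero i n c = countB-zero _ (listsOf n n) never
  where
  never : ∀ w → G-pred i n c w (⌈ lastCells w /2⌉ ℕ.≡ᵇ 0) ≡ false
  never []       = refl
  never (x ∷ xs) =
    ≡.trans (≡.cong (λ L → G-pred i n c (x ∷ xs) (⌈ L /2⌉ ℕ.≡ᵇ 0)) (lastCells-∷ x xs)) (G-pred-false i n c (x ∷ xs))

substU-Gℕ : ∀ (g : ℕ → ℕ) D (T₀ T₁ : ℕ → ℕ) K a c →
  (∀ c′ → g c′ ≡ (if D ℕ.≤ᵇ c′ then T₀ (c′ ∸ D) ℕ.+ T₁ (c′ ∸ D) else 0)) →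
  (if K ℕ.* a ℕ.≤ᵇ c then + g (c ∸ K ℕ.* a) else 0ℤ)
    ≡ + ((if K ℕ.* a ℕ.+ D ℕ.≤ᵇ c then T₀ (c ∸ (K ℕ.* a ℕ.+ D)) else 0)
         ℕ.+ (if K ℕ.* a ℕ.+ D ℕ.≤ᵇ c then T₁ (c ∸ (K ℕ.* a ℕ.+ D)) else 0))
substU-Gℕ g D T₀ T₁ K a c g≡ with K ℕ.* a ℕ.≤ᵇ c in Ka≤ᵇc
... | true rewrite g≡ (c ∸ K ℕ.* a) | ≡.sym (≤ᵇ-∸ (K ℕ.* a) D c (≤ᵇ≡true⇒≤ Ka≤ᵇc)) | ℕₚ.∸-+-assoc c (K ℕ.* a) D
  with D ℕ.≤ᵇ c ∸ K ℕ.* a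
...   | true  = refl
...   | false = refl
substU-Gℕ g D T₀ T₁ K a c g≡ | false
  rewrite >⇒≤ᵇ≡false {K ℕ.* a ℕ.+ D} {c} (ℕₚ.<-≤-trans (≤ᵇ≡false⇒> Ka≤ᵇc) (ℕₚ.m≤m+n (K ℕ.* a) D)) = refl

substU-zeroS-⊛ : ∀ K h n a c → (substU K zeroS ⊛ h) n a c ≡ 0ℤ
substU-zeroS-⊛ K h n a c = sumTo-zero n _ (λ i → sumTo-zero a _ (λ j → sumTo-zero c _ (λ l → vanishes i j l)))
  where
  vanishes : ∀ i j l → substU K zeroS i j l ℤ.* h (n ∸ i) (a ∸ j) (c ∸ l) ≡ 0ℤ
  vanishes i j l with K ℕ.* j ℕ.≤ᵇ l
  ... | true  = refl
  ... | false = refl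

Bq-x²⁺ : ∀ K i m a c → Bq K i (suc (suc m)) a c ≡ 0ℤ
Bq-x²⁺ K i m a c with K ℕ.* a ℕ.≤ᵇ c
... | false = refl
... | true  = B-x²⁺ i
  where
  B-x²⁺ : ∀ i → B i (suc (suc m)) a (c ∸ K ℕ.* a) ≡ 0ℤ
  B-x²⁺ zero                   = refl
  B-x²⁺ (suc zero)             = refl
  B-x²⁺ (suc (suc zero))       = refl
  B-x²⁺ (suc (suc (suc zero))) = refl

G-x¹ : ∀ i a c → G i 1 a c ≡ B i 1 a c
G-x¹ zero                   a c = refl
G-x¹ (suc zero)             a c = refl
G-x¹ (suc (suc zero))       a c = refl
G-x¹ (suc (suc (suc zero))) a c with (1 ℕ.≡ᵇ a) ∧ (1 ℕ.≡ᵇ c)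
... | true  = refl
... | false = refl

x²∣Mq▸Gq : ∀ K i → x^ 2 ∣ (Mq K ▸ Gq (suc K)) i
x²∣Mq▸Gq K i = x^-∣-sum4 _ (λ s → x^-∣-⊛ 1 1 (x^-∣-substU K (x∣M i s)) (x^-∣-substU (suc K) (x∣G s)))

x²∣Nq▸G1 : ∀ K i → x^ 2 ∣ (Nq K ▸ G1) i
x²∣Nq▸G1 K i = x^-∣-sum4 _ (λ s → x^-∣-⊛ 1 1 (x^-∣-substU K (x∣N i s)) (x∣G1 s))

functionalEquation-x⁰ : ∀ K i a c → Gq K i 0 a c ≡ ((Mq K ▸ Gq (suc K)) i ⊕ Bq⊖NqG1 K i) 0 a c
functionalEquation-x⁰ K i a c = ≡.trans (x^-∣-substU K (x∣G i) 0 (s≤s z≤n) a c)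
  (≡.sym (≡.cong₂ ℤ._+_ (x^-∣-weaken (s≤s z≤n) (x²∣Mq▸Gq K i) 0 (s≤s z≤n) a c) (x∣Bq⊖NqG1 K i 0 (s≤s z≤n) a c)))

functionalEquation-x¹ : ∀ K i a c → Gq K i 1 a c ≡ ((Mq K ▸ Gq (suc K)) i ⊕ Bq⊖NqG1 K i) 1 a c
functionalEquation-x¹ K i a c
  rewrite x²∣Mq▸Gq K i 1 (s≤s (s≤s z≤n)) a c | x²∣Nq▸G1 K i 1 (s≤s (s≤s z≤n)) a c =
  ≡.trans Gq≡Bq (≡.sym (≡.trans (ℤₚ.+-identityˡ _) (ℤₚ.+-identityʳ _)))
  where
  Gq≡Bq : Gq K i 1 a c ≡ Bq K i 1 a c
  Gq≡Bq with K ℕ.* a ℕ.≤ᵇ c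
  ... | true  = G-x¹ i a (c ∸ K ℕ.* a)
  ... | false = refl

row-rearrange : ∀ (b x₀ y₀ x₁ y₁ x₂ y₂ x₃ y₃ : ℤ) →
  (x₀ ℤ.+ (x₁ ℤ.+ (x₂ ℤ.+ x₃))) ℤ.+ (b ℤ.- (y₀ ℤ.+ (y₁ ℤ.+ (y₂ ℤ.+ y₃))))
    ≡ b ℤ.+ ((x₀ ℤ.- y₀) ℤ.+ ((x₁ ℤ.- y₁) ℤ.+ ((x₂ ℤ.- y₂) ℤ.+ (x₃ ℤ.- y₃))))
row-rearrange = solve 9 (λ b x₀ y₀ x₁ y₁ x₂ y₂ x₃ y₃ →
    (x₀ :+ (x₁ :+ (x₂ :+ x₃))) :+ (b :- (y₀ :+ (y₁ :+ (y₂ :+ y₃))))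
  := b :+ ((x₀ :- y₀) :+ ((x₁ :- y₁) :+ ((x₂ :- y₂) :+ (x₃ :- y₃))))) refl
  where open ℤ-Solver

column : ℕ → Fin 4 → Fin 4 → ℕ → ℕ → ℕ → ℤ
column K i k n a c = (Mq K i k ⊛ Gq (suc K) k) n a c ℤ.- (Nq K i k ⊛ G1 k) n a c

row-x²⁺ : ∀ K i m a c (e : Fin 4 → ℕ) → (∀ k → column K i k (suc (suc m)) a c ≡ + e k) →
  ((Mq K ▸ Gq (suc K)) i ⊕ Bq⊖NqG1 K i) (suc (suc m)) a c ≡ + (e i0 ℕ.+ (e i1 ℕ.+ (e i2 ℕ.+ e i3)))
row-x²⁺ K i m a c e column≡e =
  ≡.trans (row-rearrange (Bq K i (suc (suc m)) a c) (X i0) (Y i0) (X i1) (Y i1) (X i2) (Y i2) (X i3) (Y i3))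
    (≡.trans (≡.cong₂ ℤ._+_ (Bq-x²⁺ K i m a c)
               (≡.cong₂ ℤ._+_ (column≡e i0) (≡.cong₂ ℤ._+_ (column≡e i1) (≡.cong₂ ℤ._+_ (column≡e i2) (column≡e i3)))))
      (ℤₚ.+-identityˡ _))
  where
  X Y : Fin 4 → ℤ
  X k = (Mq K i k ⊛ Gq (suc K) k) (suc (suc m)) a c
  Y k = (Nq K i k ⊛ G1 k) (suc (suc m)) a c

zero-column : ∀ K k n a c → (substU K zeroS ⊛ Gq (suc K) k) n a c ℤ.- (substU K zeroS ⊛ G1 k) n a c ≡ + 0
zero-column K k n a c rewrite substU-zeroS-⊛ K (Gq (suc K) k) n a c | substU-zeroS-⊛ K (G1 k) n a c = refl

Gq-u⁰≡0 : ∀ K i n c → Gq K i n 0 c ≡ + 0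
Gq-u⁰≡0 K i n c rewrite ℕₚ.*-zeroʳ K | Gℕ-zero i n c = refl

entries : ℕ → ℕ → ℕ → ℕ → Fin 4 → ℕ
entries e₀ e₁ e₂ e₃ zero                   = e₀
entries e₀ e₁ e₂ e₃ (suc zero)             = e₁
entries e₀ e₁ e₂ e₃ (suc (suc zero))       = e₂
entries e₀ e₁ e₂ e₃ (suc (suc (suc zero))) = e₃

module Rows (K m c : ℕ) where

  -- The value of M-part⊖N-part for entries with α′ = 1, which all entries of N have.
  tail : Fin 4 → ℕ → ℕ → ℕ → ℕ
  tail s α β′ a = if (1 ℕ.≤ᵇ a) ∧ (qExp K 1 β′ a ℕ.≤ᵇ c) then Gℕ≥ s (suc m) (suc a ∸ α) (c ∸ qExp K 1 β′ a) else 0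

  1+[a∸2]≡0+[a∸1] : ∀ a → 2 ≤ a → 1 ℕ.+ (a ∸ 2) ≡ 0 ℕ.+ (a ∸ 1)
  1+[a∸2]≡0+[a∸1] (suc (suc a)) (s≤s (s≤s _)) = refl

  2+[a∸2]≡1+[a∸1] : ∀ a → 2 ≤ a → 2 ℕ.+ (a ∸ 2) ≡ 1 ℕ.+ (a ∸ 1)
  2+[a∸2]≡1+[a∸1] (suc (suc a)) (s≤s (s≤s _)) = refl

  row₀ : ∀ a → Gq K i0 (suc (suc m)) a c ≡ ((Mq K ▸ Gq (suc K)) i0 ⊕ Bq⊖NqG1 K i0) (suc (suc m)) a c
  row₀ a = ≡.trans (lhs a) (≡.sym (row-x²⁺ K i0 m a c e columns))
    where
    e = entries 0 0 (tail i2 1 1 a) (tail i3 1 1 a)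
    lhs : ∀ a → Gq K i0 (suc (suc m)) a c ≡ + (tail i2 1 1 a ℕ.+ tail i3 1 1 a)
    lhs zero    = Gq-u⁰≡0 K i0 (suc (suc m)) c
    lhs (suc a) = substU-Gℕ (Gℕ i0 (suc (suc m)) (suc a)) (suc a) (Gℕ≥ i2 (suc m) (suc a)) (Gℕ≥ i3 (suc m) (suc a))
                    K (suc a) c (Gℕ-last-column₀ m a)
    columns : ∀ k → column K i0 k (suc (suc m)) a c ≡ + e k
    columns zero                   = zero-column K i0 (suc (suc m)) a c
    columns (suc zero)             = zero-column K i1 (suc (suc m)) a c
    columns (suc (suc zero))       = M-part⊖N-part K 1 1 1 1 i2 (suc m) a c ℕₚ.≤-refl (λ _ _ → refl)
    columns (suc (suc (suc zero))) = M-part⊖N-part K 1 1 1 1 i3 (suc m) a c ℕₚ.≤-refl (λ _ _ → refl)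

  row₁ : ∀ a → Gq K i1 (suc (suc m)) a c ≡ ((Mq K ▸ Gq (suc K)) i1 ⊕ Bq⊖NqG1 K i1) (suc (suc m)) a c
  row₁ a = ≡.trans (lhs a) (≡.sym (row-x²⁺ K i1 m a c e columns))
    where
    e = entries 0 0 (tail i2 2 0 a) (tail i3 1 0 a)
    lhs : ∀ a → Gq K i1 (suc (suc m)) a c ≡ + (tail i2 2 0 a ℕ.+ tail i3 1 0 a)
    lhs zero    = Gq-u⁰≡0 K i1 (suc (suc m)) c
    lhs (suc a) = substU-Gℕ (Gℕ i1 (suc (suc m)) (suc a)) a (Gℕ≥ i2 (suc m) a) (Gℕ≥ i3 (suc m) (suc a)) K (suc a) c
                    (Gℕ-last-column₁ m a)
    columns : ∀ k → column K i1 k (suc (suc m)) a c ≡ + e k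
    columns zero                   = zero-column K i0 (suc (suc m)) a c
    columns (suc zero)             = zero-column K i1 (suc (suc m)) a c
    columns (suc (suc zero))       = M-part⊖N-part K 2 1 1 0 i2 (suc m) a c (s≤s z≤n) 1+[a∸2]≡0+[a∸1]
    columns (suc (suc (suc zero))) = M-part⊖N-part K 1 0 1 0 i3 (suc m) a c ℕₚ.≤-refl (λ _ _ → refl)

  row₂ : ∀ a → Gq K i2 (suc (suc m)) a c ≡ ((Mq K ▸ Gq (suc K)) i2 ⊕ Bq⊖NqG1 K i2) (suc (suc m)) a c
  row₂ a = ≡.trans (lhs a) (≡.sym (row-x²⁺ K i2 m a c e columns))
    where
    e = entries (tail i0 1 1 a) (tail i1 1 1 a) 0 0
    lhs : ∀ a → Gq K i2 (suc (suc m)) a c ≡ + (tail i0 1 1 a ℕ.+ (tail i1 1 1 a ℕ.+ 0))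
    lhs zero    = Gq-u⁰≡0 K i2 (suc (suc m)) c
    lhs (suc a) = ≡.trans (substU-Gℕ (Gℕ i2 (suc (suc m)) (suc a)) (suc a) (Gℕ≥ i0 (suc m) (suc a)) (Gℕ≥ i1 (suc m) (suc a))
                             K (suc a) c (Gℕ-last-column₂ m a))
                    (≡.cong (λ t → + (tail i0 1 1 (suc a) ℕ.+ t)) (≡.sym (ℕₚ.+-identityʳ _)))
    columns : ∀ k → column K i2 k (suc (suc m)) a c ≡ + e k
    columns zero                   = M-part⊖N-part K 1 1 1 1 i0 (suc m) a c ℕₚ.≤-refl (λ _ _ → refl)
    columns (suc zero)             = M-part⊖N-part K 1 1 1 1 i1 (suc m) a c ℕₚ.≤-refl (λ _ _ → refl)
    columns (suc (suc zero))       = zero-column K i2 (suc (suc m)) a c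
    columns (suc (suc (suc zero))) = zero-column K i3 (suc (suc m)) a c

  row₃ : ∀ a → Gq K i3 (suc (suc m)) a c ≡ ((Mq K ▸ Gq (suc K)) i3 ⊕ Bq⊖NqG1 K i3) (suc (suc m)) a c
  row₃ a = ≡.trans (lhs a) (≡.sym (row-x²⁺ K i3 m a c e columns))
    where
    e = entries (tail i0 2 1 a) (tail i1 1 1 a) 0 0
    lhs : ∀ a → Gq K i3 (suc (suc m)) a c ≡ + (tail i0 2 1 a ℕ.+ (tail i1 1 1 a ℕ.+ 0))
    lhs zero    = Gq-u⁰≡0 K i3 (suc (suc m)) c
    lhs (suc a) = ≡.trans (substU-Gℕ (Gℕ i3 (suc (suc m)) (suc a)) (suc a) (Gℕ≥ i0 (suc m) a) (Gℕ≥ i1 (suc m) (suc a))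
                             K (suc a) c (Gℕ-last-column₃ m a))
                    (≡.cong (λ t → + (tail i0 2 1 (suc a) ℕ.+ t)) (≡.sym (ℕₚ.+-identityʳ _)))
    columns : ∀ k → column K i3 k (suc (suc m)) a c ≡ + e k
    columns zero                   = M-part⊖N-part K 2 2 1 1 i0 (suc m) a c (s≤s z≤n) 2+[a∸2]≡1+[a∸1]
    columns (suc zero)             = M-part⊖N-part K 1 1 1 1 i1 (suc m) a c ℕₚ.≤-refl (λ _ _ → refl)
    columns (suc (suc zero))       = zero-column K i2 (suc (suc m)) a c
    columns (suc (suc (suc zero))) = zero-column K i3 (suc (suc m)) a c

functionalEquation : FunctionalEquation
functionalEquation K i = coefficientwise (λ n a c → at n i a c)
  where
  at : ∀ n i a c → Gq K i n a c ≡ ((Mq K ▸ Gq (suc K)) i ⊕ Bq⊖NqG1 K i) n a c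
  at zero          i                      a c = functionalEquation-x⁰ K i a c
  at (suc zero)    i                      a c = functionalEquation-x¹ K i a c
  at (suc (suc m)) zero                   a c = Rows.row₀ K m c a
  at (suc (suc m)) (suc zero)             a c = Rows.row₁ K m c a
  at (suc (suc m)) (suc (suc zero))       a c = Rows.row₂ K m c a
  at (suc (suc m)) (suc (suc (suc zero))) a c = Rows.row₃ K m c a

theorem2p3 : (i : Fin 4) (n a c : ℕ) →
    ((k : ℕ) → n < k → term k i n a c ≡ 0ℤ) ×
    (G i n a c ≡ sumTo n (λ k → term k i n a c))
theorem2p3 i n a c =
  (λ k n<k → x^k+1∣term k i n (ℕₚ.<-≤-trans n<k (ℕₚ.m≤m+n k 1)) a c) ,
  Iteration.G-coeff functionalEquation i n a c
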